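{- Let $p\geq 5$ be prime. Res(lin$_{\mathbb{F}_p}$) p-simulates Res(lin$^{\neq}_{\mathbb{F}_p}$): there is a polynomial $q$ such that for every set $\Phi$ of Res(lin$^{\neq}_{\mathbb{F}_p}$) clauses in variables $x_1,\dots,x_n$ having a Res(lin$^{\neq}_{\mathbb{F}_p}$) refutation of size $S$, the set $\{\langle C\rangle: C\in\Phi\}$ has a Res(lin$_{\mathbb{F}_p}$) refutation of size at most $q(S+n)$, where the translation $\langle\cdot\rangle$ is: for an inequality $f\neq a$, $\langle f\neq a\rangle:=\bigvee_{b\in f(\{0,1\}^n),\,b\neq a}(f=b)$, and for a clause $C=(f_1\neq a_1\vee\dots\vee f_m\neq a_m)$, $\langle C\rangle:=\langle f_1\neq a_1\rangle\vee\dots\vee\langle f_m\neq a_m\rangle$.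
   Context: $f(\{0,1\}^n)\subseteq\mathbb{F}_p$ is the set of values of a linear polynomial $f$ on Boolean assignments. Res(lin$_{\mathbb{F}_p}$): proof lines are disjunctions of linear equations over $\mathbb{F}_p$. Rules: from $C\vee f=0$ and $D\vee g=0$ derive $C\vee D\vee(\alpha f+\beta g)=0$ ($\alpha,\beta\in\mathbb{F}_p$); from $C\vee a=0$ with $0\neq a\in\mathbb{F}_p$ derive $C$; from $C$ derive $C\vee f=0$. Boolean axioms: $x_i=0\vee x_i=1$. Res(lin$^{\neq}_{\mathbb{F}_p}$): proof lines are disjunctions of linear inequalities $f\neq a$ over $\mathbb{F}_p$. Rules: Resolution: from $C_0\vee f\neq 0$, $C_1\vee f\neq 1$, $\dots$, $C_{p-1}\vee f\neq p-1$ derive $C_0\vee\dots\vee C_{p-1}$; Simplification: from $C\vee 0\neq 0$ derive $C$; Linear combination: from $C\vee f\neq a$ derive $C\vee f+g\neq a+b\vee g\neq b$ ($a,b\in\mathbb{F}_p$, $g$ a linear polynomial). Boolean axioms: the unit clauses $x_i\neq 2,\dots,x_i\neq p-1$. In both systems a derivation from a set of clauses is a sequence of clauses each of which is in the set, a Boolean axiom, or follows from earlier ones by a rule; a refutation is a derivation of the empty clause; size is the total size of the sequence. -}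

module Defs where

open import Data.Nat using (ℕ; zero; suc; _+_; _*_; _∸_; _^_; NonZero)
open import Data.Nat.DivMod using (_mod_)
open import Data.Nat.ListAction using (sum)
open import Data.Fin using (Fin; toℕ; fromℕ<)
open import Data.Fin.Base using (fromℕ)
open import Data.Bool using (Bool; true; false; if_then_else_)
open import Data.Vec using (Vec; []; _∷_; lookup; replicate; zipWith; toList)
open import Data.List using (List; []; _∷_; _++_; map; foldr; filter; allFin; concatMap; concat; length)
open import Data.List.Membership.Propositional using (_∈_)
open import Data.List.Relation.Unary.Any using (Any)
open import Data.Product using (Σ; _×_; _,_; ∃; ∃-syntax)
open import Data.Sum using (_⊎_)
open import Relation.Binary.PropositionalEquality using (_≡_; _≢_)
open import Relation.Nullary using (¬_; Dec; yes; no)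
open import Relation.Nullary.Decidable using (⌊_⌋)
import Data.Fin.Properties as FinP
open import Data.List.Relation.Unary.Any using (any?)

-- Clauses as sets: two lists denote the same disjunction iff they have
-- the same elements.

_≈ₛ_ : {A : Set} → List A → List A → Set
xs ≈ₛ ys = ∀ x → (x ∈ xs → x ∈ ys) × (x ∈ ys → x ∈ xs)

-- Polynomials with natural coefficients (list of coefficients, constant first)

Poly : Set
Poly = List ℕ

evalPoly : Poly → ℕ → ℕ
evalPoly [] x = 0
evalPoly (c ∷ cs) x = c + x * evalPoly cs x

assignments : (n : ℕ) → List (Vec Bool n)
assignments zero = [] ∷ []
assignments (suc n) = concatMap (λ v → (false ∷ v) ∷ (true ∷ v) ∷ []) (assignments n)

module _ (p : ℕ) .{{_ : NonZero p}} where

  F : Set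
  F = Fin p

  0F : F
  0F = 0 mod p

  1F : F
  1F = 1 mod p

  _+F_ : F → F → F
  a +F b = (toℕ a + toℕ b) mod p

  _*F_ : F → F → F
  a *F b = (toℕ a * toℕ b) mod p

  -F_ : F → F
  -F a = (p ∸ toℕ a) mod p

  record Lin (n : ℕ) : Set where
    constructor lin
    field
      coeffs : Vec F n
      const  : F
  open Lin public

  constLin : {n : ℕ} → F → Lin n
  constLin a = lin (replicate _ 0F) a

  varLin : {n : ℕ} → Fin n → Lin n
  varLin {n} i = lin (Data.Vec.tabulate (λ j → if ⌊ FinP._≟_ i j ⌋ then 1F else 0F)) 0F

  _+L_ : {n : ℕ} → Lin n → Lin n → Lin n
  f +L g = lin (zipWith _+F_ (coeffs f) (coeffs g)) (const f +F const g)

  _·L_ : {n : ℕ} → F → Lin n → Lin n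
  a ·L f = lin (Data.Vec.map (a *F_) (coeffs f)) (a *F const f)

  _-c_ : {n : ℕ} → Lin n → F → Lin n
  f -c b = lin (coeffs f) (const f +F (-F b))

  boolToF : Bool → F
  boolToF false = 0F
  boolToF true  = 1F

  evalLin : {n : ℕ} → Lin n → Vec Bool n → F
  evalLin f α = foldr _+F_ (const f) (toList (zipWith (λ c b → c *F boolToF b) (coeffs f) α))

  -- the value set f({0,1}^n) ⊆ F_p, listed in increasing order
  image : {n : ℕ} → Lin n → List F
  image {n} f = filter (λ b → any? (λ α → FinP._≟_ (evalLin f α) b) (assignments n)) (allFin p)

  -- size: number of nonzero coefficients (including the constant term)
  nnz : List F → ℕ
  nnz [] = 0
  nnz (a ∷ as) = (if ⌊ FinP._≟_ a 0F ⌋ then 0 else 1) + nnz as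

  sizeLin : {n : ℕ} → Lin n → ℕ
  sizeLin f = nnz (const f ∷ toList (coeffs f))

  -- Res(lin_{F_p}): a clause is a list of linear polynomials f,
  -- denoting the disjunction of the equations f = 0.

  LClause : ℕ → Set
  LClause n = List (Lin n)

  -- the equation  f = b  is represented as  f - b = 0
  eqLit : {n : ℕ} → Lin n → F → Lin n
  eqLit f b = f -c b

  LBoolAxiom : {n : ℕ} → Fin n → LClause n
  LBoolAxiom i = eqLit (varLin i) 0F ∷ eqLit (varLin i) 1F ∷ []

  data LJustified {n : ℕ} (Φ : List (LClause n)) (prev : List (LClause n)) (K : LClause n) : Set where
    ax     : Any (λ C → K ≈ₛ C) Φ → LJustified Φ prev K
    bool   : (i : Fin n) → K ≈ₛ LBoolAxiom i → LJustified Φ prev K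
    comb   : (L₁ L₂ C D : LClause n) (f g : Lin n) (α β : F) →
             L₁ ∈ prev → L₂ ∈ prev →
             L₁ ≈ₛ (f ∷ C) → L₂ ≈ₛ (g ∷ D) →
             K ≈ₛ (((α ·L f) +L (β ·L g)) ∷ (C ++ D)) → LJustified Φ prev K
    simp   : (L C : LClause n) (a : F) → a ≢ 0F →
             L ∈ prev → L ≈ₛ (constLin a ∷ C) → K ≈ₛ C → LJustified Φ prev K
    weaken : (L : LClause n) (f : Lin n) →
             L ∈ prev → K ≈ₛ (f ∷ L) → LJustified Φ prev K

  -- A derivation, stored last-line-first: (Kₘ ∷ ... ∷ K₁)
  data LDerivation {n : ℕ} (Φ : List (LClause n)) : List (LClause n) → Set where
    []  : LDerivation Φ []
    _∷_ : {prev : List (LClause n)} {K : LClause n} →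
          LJustified Φ prev K → LDerivation Φ prev → LDerivation Φ (K ∷ prev)

  LRefutation : {n : ℕ} → List (LClause n) → List (LClause n) → Set
  LRefutation Φ π = LDerivation Φ π × Σ _ (λ rest → π ≡ [] ∷ rest)

  sizeLClause : {n : ℕ} → LClause n → ℕ
  sizeLClause C = suc (sum (map (λ f → suc (sizeLin f)) C))

  sizeL : {n : ℕ} → List (LClause n) → ℕ
  sizeL π = sum (map sizeLClause π)

  -- Res(lin^≠_{F_p}): a literal (f , a) denotes f ≠ a.

  NLit : ℕ → Set
  NLit n = Lin n × F

  NClause : ℕ → Set
  NClause n = List (NLit n)

  data NJustified {n : ℕ} (Φ : List (NClause n)) (prev : List (NClause n)) (K : NClause n) : Set where
    ax    : Any (λ C → K ≈ₛ C) Φ → NJustified Φ prev K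
    bool  : (i : Fin n) (k : F) → 2 Data.Nat.≤ toℕ k →
            K ≈ₛ ((varLin i , k) ∷ []) → NJustified Φ prev K
    res   : (f : Lin n) (L C : F → NClause n) →
            (∀ j → L j ∈ prev) → (∀ j → L j ≈ₛ ((f , j) ∷ C j)) →
            K ≈ₛ concat (map C (allFin p)) → NJustified Φ prev K
    simp  : (L C : NClause n) → L ∈ prev →
            L ≈ₛ ((constLin 0F , 0F) ∷ C) → K ≈ₛ C → NJustified Φ prev K
    lcomb : (L C : NClause n) (f g : Lin n) (a b : F) → L ∈ prev →
            L ≈ₛ ((f , a) ∷ C) →
            K ≈ₛ (C ++ ((f +L g) , (a +F b)) ∷ (g , b) ∷ []) → NJustified Φ prev K

  data NDerivation {n : ℕ} (Φ : List (NClause n)) : List (NClause n) → Set where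
    []  : NDerivation Φ []
    _∷_ : {prev : List (NClause n)} {K : NClause n} →
          NJustified Φ prev K → NDerivation Φ prev → NDerivation Φ (K ∷ prev)

  NRefutation : {n : ℕ} → List (NClause n) → List (NClause n) → Set
  NRefutation Φ π = NDerivation Φ π × Σ _ (λ rest → π ≡ [] ∷ rest)

  sizeNClause : {n : ℕ} → NClause n → ℕ
  sizeNClause C = suc (sum (map (λ l → suc (sizeLin (Data.Product.proj₁ l)) + nnz (Data.Product.proj₂ l ∷ [])) C))

  sizeN : {n : ℕ} → List (NClause n) → ℕ
  sizeN π = sum (map sizeNClause π)

  transLit : {n : ℕ} → NLit n → LClause n
  transLit (f , a) = map (eqLit f) (filter (λ b → Relation.Nullary.¬? (FinP._≟_ b a)) (image f))

  transClause : {n : ℕ} → NClause n → LClause n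
  transClause C = concat (map transLit C)

module Submission where

-- A Res(lin≠) line K is simulated by a Res(lin) line that is a subclause of ⟨K⟩. Axioms and
-- simplification translate directly. The basic Res(lin) move is to cut an equation h = u against a
-- line whose h-literals are h = d with d ≠ u: combining (h - u) - (h - d) gives the nonzero constant
-- d - u, which simplification deletes. Resolution on f ≠ 0, …, f ≠ p - 1 is a sequence of such cuts.
-- For the linear combination rule one first derives, variable by variable from the Boolean axioms,
-- the clause ⋁_{e ∈ h({0,1}ⁿ)} h = e for h = g and h = f + g; adding a literal f = c of the premise
-- to g = b gives f + g = c + b, which lies in ⟨K⟩ unless it is not a value of f + g, in which case it
-- is cut away against that clause. Every line is kept inside a universe of at most p S + 4 p + 2
-- literals, so each of the O(p² S (S + n)) lines has size O(p S n).

open import Defs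
open import Data.Nat using (ℕ; zero; suc; _+_; _*_; _∸_; _%_; _≤_; _<_; _<?_; z≤n; s≤s; z<s; NonZero; >-nonZero⁻¹)
import Data.Nat.Properties as ℕP
open import Data.Nat.DivMod using (_mod_; m<n⇒m%n≡m; n%n≡0; %-distribˡ-+; %-distribˡ-*)
open import Data.Nat.ListAction using (sum)
open import Data.Nat.Primality using (Prime)
open import Data.Nat.Solver using (module +-*-Solver)
open import Data.Fin as Fin using (Fin; toℕ; fromℕ<)
import Data.Fin.Properties as FinP
open import Data.Vec as V using (Vec; []; _∷_; lookup; replicate; zipWith; tabulate; _[_]≔_)
import Data.Vec.Properties as VP
open import Data.List as L using (List; []; _∷_; _++_; filter; allFin; length; concat)
import Data.List.Properties as LP
open import Data.List.Membership.Propositional using (_∈_; lose; find)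
open import Data.List.Membership.Propositional.Properties
import Data.List.Membership.DecPropositional as DecMembership
open import Data.List.Relation.Unary.Any as Any using (Any; here; there; any?)
import Data.List.Relation.Unary.Any.Properties as AnyP
open import Data.List.Relation.Unary.All as All using (All; []; _∷_)
import Data.List.Relation.Unary.All.Properties as AllP
open import Function using (_∘_)
open import Data.Bool using (Bool; true; false; if_then_else_)
open import Data.Empty using (⊥; ⊥-elim)
open import Data.Sum using (_⊎_; inj₁; inj₂)
open import Data.Product using (Σ; _×_; _,_; proj₁; proj₂)
open import Relation.Binary.PropositionalEquality
open import Relation.Binary.Definitions using (tri<; tri≈; tri>)
open import Relation.Nullary using (Dec; does; yes; no; ¬?)
open import Relation.Nullary.Decidable using (⌊_⌋; dec-true; dec-false)
open import Algebra.Bundles using (CommutativeRing)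
open import Algebra.Structures using (IsCommutativeRing)

tabulate-const : ∀ {A : Set} n (x : A) → tabulate {n = n} (λ _ → x) ≡ replicate n x
tabulate-const zero    x = refl
tabulate-const (suc n) x = cong (x ∷_) (tabulate-const n x)

∈-++-self⁻ : ∀ {A : Set} {x : A} (xs : List A) → x ∈ xs ++ xs → x ∈ xs
∈-++-self⁻ xs x∈ with ∈-++⁻ xs x∈
... | inj₁ x∈xs = x∈xs
... | inj₂ x∈xs = x∈xs

length-++-≡ : ∀ {A : Set} (xs ys : List A) {a b} → length xs ≡ a → length ys ≡ b → length (xs ++ ys) ≡ a + b
length-++-≡ xs ys ∣xs∣ ∣ys∣ = trans (LP.length-++ xs) (cong₂ _+_ ∣xs∣ ∣ys∣)

module Residues (p : ℕ) .{{_ : NonZero p}} where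

  infixl 6 _⊕_
  infixl 7 _⊗_
  infix 8 ⊖_

  Fp : Set
  Fp = F p

  _⊕_ _⊗_ : Fp → Fp → Fp
  _⊕_ = _+F_ p
  _⊗_ = _*F_ p

  ⊖_ : Fp → Fp
  ⊖_ = -F_ p

  𝟘 𝟙 : Fp
  𝟘 = 0F p
  𝟙 = 1F p

  ⟦_⟧ : ℕ → Fp
  ⟦ m ⟧ = m mod p

  toℕ-⟦⟧ : ∀ m → toℕ ⟦ m ⟧ ≡ m % p
  toℕ-⟦⟧ m = FinP.toℕ-fromℕ< _

  ⟦⟧-cong : ∀ {m n} → m % p ≡ n % p → ⟦ m ⟧ ≡ ⟦ n ⟧
  ⟦⟧-cong eq = FinP.toℕ-injective (trans (toℕ-⟦⟧ _) (trans eq (sym (toℕ-⟦⟧ _))))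

  ⟦toℕ⟧ : ∀ a → ⟦ toℕ a ⟧ ≡ a
  ⟦toℕ⟧ a = FinP.toℕ-injective (trans (toℕ-⟦⟧ _) (m<n⇒m%n≡m (FinP.toℕ<n a)))

  ⟦⟧-+ : ∀ m n → ⟦ m ⟧ ⊕ ⟦ n ⟧ ≡ ⟦ m + n ⟧
  ⟦⟧-+ m n = ⟦⟧-cong (trans (cong₂ (λ x y → (x + y) % p) (toℕ-⟦⟧ m) (toℕ-⟦⟧ n)) (sym (%-distribˡ-+ m n p)))

  ⟦⟧-* : ∀ m n → ⟦ m ⟧ ⊗ ⟦ n ⟧ ≡ ⟦ m * n ⟧
  ⟦⟧-* m n = ⟦⟧-cong (trans (cong₂ (λ x y → (x * y) % p) (toℕ-⟦⟧ m) (toℕ-⟦⟧ n)) (sym (%-distribˡ-* m n p)))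

  -- Each ring law of F_p is a law of ℕ pushed through ⟦_⟧ ∘ toℕ.
  ⊕-assoc : ∀ a b c → (a ⊕ b) ⊕ c ≡ a ⊕ (b ⊕ c)
  ⊕-assoc a b c = begin
    (a ⊕ b) ⊕ c                     ≡⟨ cong ((a ⊕ b) ⊕_) (sym (⟦toℕ⟧ c)) ⟩
    ⟦ toℕ a + toℕ b ⟧ ⊕ ⟦ toℕ c ⟧   ≡⟨ ⟦⟧-+ _ _ ⟩
    ⟦ toℕ a + toℕ b + toℕ c ⟧       ≡⟨ cong ⟦_⟧ (ℕP.+-assoc (toℕ a) _ _) ⟩
    ⟦ toℕ a + (toℕ b + toℕ c) ⟧     ≡⟨ sym (⟦⟧-+ _ _) ⟩
    ⟦ toℕ a ⟧ ⊕ ⟦ toℕ b + toℕ c ⟧   ≡⟨ cong (_⊕ (b ⊕ c)) (⟦toℕ⟧ a) ⟩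
    a ⊕ (b ⊕ c)                     ∎
    where open ≡-Reasoning

  ⊗-assoc : ∀ a b c → (a ⊗ b) ⊗ c ≡ a ⊗ (b ⊗ c)
  ⊗-assoc a b c = begin
    (a ⊗ b) ⊗ c                     ≡⟨ cong ((a ⊗ b) ⊗_) (sym (⟦toℕ⟧ c)) ⟩
    ⟦ toℕ a * toℕ b ⟧ ⊗ ⟦ toℕ c ⟧   ≡⟨ ⟦⟧-* _ _ ⟩
    ⟦ toℕ a * toℕ b * toℕ c ⟧       ≡⟨ cong ⟦_⟧ (ℕP.*-assoc (toℕ a) _ _) ⟩
    ⟦ toℕ a * (toℕ b * toℕ c) ⟧     ≡⟨ sym (⟦⟧-* _ _) ⟩
    ⟦ toℕ a ⟧ ⊗ ⟦ toℕ b * toℕ c ⟧   ≡⟨ cong (_⊗ (b ⊗ c)) (⟦toℕ⟧ a) ⟩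
    a ⊗ (b ⊗ c)                     ∎
    where open ≡-Reasoning

  ⊕-comm : ∀ a b → a ⊕ b ≡ b ⊕ a
  ⊕-comm a b = cong ⟦_⟧ (ℕP.+-comm (toℕ a) (toℕ b))

  ⊗-comm : ∀ a b → a ⊗ b ≡ b ⊗ a
  ⊗-comm a b = cong ⟦_⟧ (ℕP.*-comm (toℕ a) (toℕ b))

  ⊕-identityˡ : ∀ a → 𝟘 ⊕ a ≡ a
  ⊕-identityˡ a = trans (cong (𝟘 ⊕_) (sym (⟦toℕ⟧ a))) (trans (⟦⟧-+ 0 _) (⟦toℕ⟧ a))

  ⊗-identityˡ : ∀ a → 𝟙 ⊗ a ≡ a
  ⊗-identityˡ a = begin
    𝟙 ⊗ a               ≡⟨ cong (𝟙 ⊗_) (sym (⟦toℕ⟧ a)) ⟩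
    ⟦ 1 ⟧ ⊗ ⟦ toℕ a ⟧   ≡⟨ ⟦⟧-* 1 _ ⟩
    ⟦ 1 * toℕ a ⟧       ≡⟨ cong ⟦_⟧ (ℕP.*-identityˡ (toℕ a)) ⟩
    ⟦ toℕ a ⟧           ≡⟨ ⟦toℕ⟧ a ⟩
    a                   ∎
    where open ≡-Reasoning

  ⊗-distribˡ-⊕ : ∀ a b c → a ⊗ (b ⊕ c) ≡ a ⊗ b ⊕ a ⊗ c
  ⊗-distribˡ-⊕ a b c = begin
    a ⊗ (b ⊕ c)                         ≡⟨ cong (_⊗ (b ⊕ c)) (sym (⟦toℕ⟧ a)) ⟩
    ⟦ toℕ a ⟧ ⊗ ⟦ toℕ b + toℕ c ⟧       ≡⟨ ⟦⟧-* _ _ ⟩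
    ⟦ toℕ a * (toℕ b + toℕ c) ⟧         ≡⟨ cong ⟦_⟧ (ℕP.*-distribˡ-+ (toℕ a) _ _) ⟩
    ⟦ toℕ a * toℕ b + toℕ a * toℕ c ⟧   ≡⟨ sym (⟦⟧-+ _ _) ⟩
    a ⊗ b ⊕ a ⊗ c                       ∎
    where open ≡-Reasoning

  ⊕-inverseʳ : ∀ a → a ⊕ ⊖ a ≡ 𝟘
  ⊕-inverseʳ a = begin
    a ⊕ ⊖ a                       ≡⟨ cong (_⊕ ⊖ a) (sym (⟦toℕ⟧ a)) ⟩
    ⟦ toℕ a ⟧ ⊕ ⟦ p ∸ toℕ a ⟧     ≡⟨ ⟦⟧-+ (toℕ a) _ ⟩
    ⟦ toℕ a + (p ∸ toℕ a) ⟧       ≡⟨ cong ⟦_⟧ (ℕP.m+[n∸m]≡n (ℕP.<⇒≤ (FinP.toℕ<n a))) ⟩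
    ⟦ p ⟧                         ≡⟨ ⟦⟧-cong (trans (n%n≡0 p) (sym (m<n⇒m%n≡m (>-nonZero⁻¹ p)))) ⟩
    𝟘                             ∎
    where open ≡-Reasoning

  isCommutativeRing : IsCommutativeRing _≡_ _⊕_ _⊗_ ⊖_ 𝟘 𝟙
  isCommutativeRing = record
    { isRing = record
      { +-isAbelianGroup = record
        { isGroup = record
          { isMonoid = record
            { isSemigroup = record
              { isMagma = record { isEquivalence = isEquivalence ; ∙-cong = cong₂ _⊕_ }
              ; assoc = ⊕-assoc }
            ; identity = ⊕-identityˡ , λ a → trans (⊕-comm a 𝟘) (⊕-identityˡ a) }
          ; inverse = (λ a → trans (⊕-comm (⊖ a) a) (⊕-inverseʳ a)) , ⊕-inverseʳ
          ; ⁻¹-cong = cong ⊖_ }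
        ; comm = ⊕-comm }
      ; *-cong = cong₂ _⊗_
      ; *-assoc = ⊗-assoc
      ; *-identity = ⊗-identityˡ , λ a → trans (⊗-comm a 𝟙) (⊗-identityˡ a)
      ; distrib = ⊗-distribˡ-⊕ , λ a b c → trans (⊗-comm (b ⊕ c) a)
                    (trans (⊗-distribˡ-⊕ a b c) (cong₂ _⊕_ (⊗-comm a b) (⊗-comm a c))) }
    ; *-comm = ⊗-comm }

  commutativeRing : CommutativeRing _ _
  commutativeRing = record { isCommutativeRing = isCommutativeRing }

  open CommutativeRing commutativeRing public
    using (+-identityʳ; *-identityʳ; zeroˡ; zeroʳ; -‿inverseʳ)
  open import Algebra.Properties.Ring (CommutativeRing.ring commutativeRing) public
    using (-1*x≈-x; -‿distribʳ-*)
  open import Algebra.Properties.AbelianGroup (CommutativeRing.+-abelianGroup commutativeRing) public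
    using (⁻¹-∙-comm; ⁻¹-involutive; ∙-cancelʳ; x∙y⁻¹≈ε⇒x≈y)
  -- The solver only knows natural coefficients, so negated terms are handed to it as atoms.
  open import Algebra.Solver.Ring.NaturalCoefficients.Default
    (CommutativeRing.commutativeSemiring commutativeRing) public
    using (solve; _:+_; _:*_; _:=_)

  ⊖-distrib-⊕ : ∀ x y → ⊖ (x ⊕ y) ≡ ⊖ x ⊕ ⊖ y
  ⊖-distrib-⊕ x y = sym (⁻¹-∙-comm x y)

  difference≢𝟘 : ∀ {u v} → u ≢ v → v ⊕ ⊖ u ≢ 𝟘
  difference≢𝟘 {u} {v} u≢v eq = u≢v (sym (x∙y⁻¹≈ε⇒x≈y v u eq))

module LinearForm (p : ℕ) .{{_ : NonZero p}} where
  open Residues p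

  infixl 6 _+ᴸ_
  infixl 7 _·ᴸ_
  infixl 5 _-ᶜ_

  Form : ℕ → Set
  Form = Lin p

  _+ᴸ_ : ∀ {n} → Form n → Form n → Form n
  _+ᴸ_ = _+L_ p

  _·ᴸ_ : ∀ {n} → Fp → Form n → Form n
  _·ᴸ_ = _·L_ p

  _-ᶜ_ : ∀ {n} → Form n → Fp → Form n
  _-ᶜ_ = _-c_ p

  cst : ∀ {n} → Fp → Form n
  cst = constLin p

  var : ∀ {n} → Fin n → Form n
  var = varLin p

  eval : ∀ {n} → Form n → Vec Bool n → Fp
  eval = evalLin p

  bit : Bool → Fp
  bit = boolToF p

  Im : ∀ {n} → Form n → List Fp
  Im = image p

  _≟ᴸ_ : ∀ {n} (f g : Form n) → Dec (f ≡ g)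
  lin cs k ≟ᴸ lin ds l with VP.≡-dec FinP._≟_ cs ds | k FinP.≟ l
  ... | yes refl | yes refl = yes refl
  ... | no cs≢ds | _        = no λ { refl → cs≢ds refl }
  ... | _        | no k≢l   = no λ { refl → k≢l refl }

  shift-cancel : ∀ {n} (h : Form n) u v → (𝟙 ·ᴸ (h -ᶜ u)) +ᴸ ((⊖ 𝟙) ·ᴸ (h -ᶜ v)) ≡ cst (v ⊕ ⊖ u)
  shift-cancel (lin cs k) u v = cong₂ lin (coefficients cs) constant
    where
    coefficients : ∀ {n} (xs : Vec Fp n) →
                   zipWith _⊕_ (V.map (𝟙 ⊗_) xs) (V.map ((⊖ 𝟙) ⊗_) xs) ≡ replicate n 𝟘
    coefficients [] = refl
    coefficients (x ∷ xs) =
      cong₂ _∷_ (trans (cong₂ _⊕_ (⊗-identityˡ x) (-1*x≈-x x)) (-‿inverseʳ x)) (coefficients xs)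
    constant : 𝟙 ⊗ (k ⊕ ⊖ u) ⊕ (⊖ 𝟙) ⊗ (k ⊕ ⊖ v) ≡ v ⊕ ⊖ u
    constant = begin
      𝟙 ⊗ (k ⊕ ⊖ u) ⊕ (⊖ 𝟙) ⊗ (k ⊕ ⊖ v)  ≡⟨ cong₂ _⊕_ (⊗-identityˡ _) (-1*x≈-x _) ⟩
      (k ⊕ ⊖ u) ⊕ ⊖ (k ⊕ ⊖ v)            ≡⟨ cong ((k ⊕ ⊖ u) ⊕_) (trans (⊖-distrib-⊕ k (⊖ v)) (cong (⊖ k ⊕_) (⁻¹-involutive v))) ⟩
      (k ⊕ ⊖ u) ⊕ (⊖ k ⊕ v)              ≡⟨ solve 4 (λ k u′ k′ v → (k :+ u′) :+ (k′ :+ v) := (k :+ k′) :+ (v :+ u′)) refl k (⊖ u) (⊖ k) v ⟩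
      (k ⊕ ⊖ k) ⊕ (v ⊕ ⊖ u)              ≡⟨ cong (_⊕ (v ⊕ ⊖ u)) (-‿inverseʳ k) ⟩
      𝟘 ⊕ (v ⊕ ⊖ u)                      ≡⟨ ⊕-identityˡ _ ⟩
      v ⊕ ⊖ u                            ∎
      where open ≡-Reasoning

  shift-add-scaled : ∀ {n} (f g : Form n) c w b →
                     (𝟙 ·ᴸ (f -ᶜ c)) +ᴸ (w ·ᴸ (g -ᶜ b)) ≡ (f +ᴸ w ·ᴸ g) -ᶜ (c ⊕ w ⊗ b)
  shift-add-scaled (lin cs k) (lin ds l) c w b = cong₂ lin (coefficients cs ds) constant
    where
    coefficients : ∀ {n} (xs ys : Vec Fp n) →
                   zipWith _⊕_ (V.map (𝟙 ⊗_) xs) (V.map (w ⊗_) ys) ≡ zipWith _⊕_ xs (V.map (w ⊗_) ys)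
    coefficients [] [] = refl
    coefficients (x ∷ xs) (y ∷ ys) = cong₂ _∷_ (cong (_⊕ w ⊗ y) (⊗-identityˡ x)) (coefficients xs ys)
    constant : 𝟙 ⊗ (k ⊕ ⊖ c) ⊕ w ⊗ (l ⊕ ⊖ b) ≡ (k ⊕ w ⊗ l) ⊕ ⊖ (c ⊕ w ⊗ b)
    constant = begin
      𝟙 ⊗ (k ⊕ ⊖ c) ⊕ w ⊗ (l ⊕ ⊖ b)      ≡⟨ cong (_⊕ w ⊗ (l ⊕ ⊖ b)) (⊗-identityˡ _) ⟩
      (k ⊕ ⊖ c) ⊕ w ⊗ (l ⊕ ⊖ b)
        ≡⟨ solve 5 (λ k c′ w l b′ → (k :+ c′) :+ w :* (l :+ b′) := (k :+ w :* l) :+ (c′ :+ w :* b′)) refl k (⊖ c) w l (⊖ b) ⟩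
      (k ⊕ w ⊗ l) ⊕ (⊖ c ⊕ w ⊗ ⊖ b)      ≡⟨ cong (λ z → (k ⊕ w ⊗ l) ⊕ (⊖ c ⊕ z)) (sym (-‿distribʳ-* w b)) ⟩
      (k ⊕ w ⊗ l) ⊕ (⊖ c ⊕ ⊖ (w ⊗ b))    ≡⟨ cong ((k ⊕ w ⊗ l) ⊕_) (sym (⊖-distrib-⊕ c (w ⊗ b))) ⟩
      (k ⊕ w ⊗ l) ⊕ ⊖ (c ⊕ w ⊗ b)        ∎
      where open ≡-Reasoning

  shift-add : ∀ {n} (f g : Form n) c b → (𝟙 ·ᴸ (f -ᶜ c)) +ᴸ (𝟙 ·ᴸ (g -ᶜ b)) ≡ (f +ᴸ g) -ᶜ (c ⊕ b)
  shift-add f g c b = begin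
    (𝟙 ·ᴸ (f -ᶜ c)) +ᴸ (𝟙 ·ᴸ (g -ᶜ b))  ≡⟨ shift-add-scaled f g c 𝟙 b ⟩
    (f +ᴸ 𝟙 ·ᴸ g) -ᶜ (c ⊕ 𝟙 ⊗ b)        ≡⟨ cong₂ (λ h a → (f +ᴸ h) -ᶜ (c ⊕ a)) (·ᴸ-identityˡ g) (⊗-identityˡ b) ⟩
    (f +ᴸ g) -ᶜ (c ⊕ b)                 ∎
    where
    open ≡-Reasoning
    ·ᴸ-identityˡ : ∀ {n} (h : Form n) → 𝟙 ·ᴸ h ≡ h
    ·ᴸ-identityˡ (lin cs k) = cong₂ lin (trans (VP.map-cong ⊗-identityˡ cs) (VP.map-id cs)) (⊗-identityˡ k)

  shift-scale : ∀ {n} (g : Form n) c w b →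
                (w ·ᴸ (g -ᶜ b)) +ᴸ (𝟘 ·ᴸ (g -ᶜ b)) ≡ (cst c +ᴸ w ·ᴸ g) -ᶜ (c ⊕ w ⊗ b)
  shift-scale (lin ds l) c w b = cong₂ lin (coefficients ds) constant
    where
    coefficients : ∀ {n} (xs : Vec Fp n) →
                   zipWith _⊕_ (V.map (w ⊗_) xs) (V.map (𝟘 ⊗_) xs) ≡ zipWith _⊕_ (replicate n 𝟘) (V.map (w ⊗_) xs)
    coefficients [] = refl
    coefficients (x ∷ xs) =
      cong₂ _∷_ (trans (cong (w ⊗ x ⊕_) (zeroˡ x)) (⊕-comm (w ⊗ x) 𝟘)) (coefficients xs)
    constant : w ⊗ (l ⊕ ⊖ b) ⊕ 𝟘 ⊗ (l ⊕ ⊖ b) ≡ (c ⊕ w ⊗ l) ⊕ ⊖ (c ⊕ w ⊗ b)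
    constant = begin
      w ⊗ (l ⊕ ⊖ b) ⊕ 𝟘 ⊗ (l ⊕ ⊖ b)      ≡⟨ trans (cong (w ⊗ (l ⊕ ⊖ b) ⊕_) (zeroˡ _)) (+-identityʳ _) ⟩
      w ⊗ (l ⊕ ⊖ b)                      ≡⟨ sym (⊕-identityˡ _) ⟩
      𝟘 ⊕ w ⊗ (l ⊕ ⊖ b)                  ≡⟨ cong (_⊕ w ⊗ (l ⊕ ⊖ b)) (sym (-‿inverseʳ c)) ⟩
      (c ⊕ ⊖ c) ⊕ w ⊗ (l ⊕ ⊖ b)
        ≡⟨ solve 5 (λ c c′ w l b′ → (c :+ c′) :+ w :* (l :+ b′) := (c :+ w :* l) :+ (c′ :+ w :* b′)) refl c (⊖ c) w l (⊖ b) ⟩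
      (c ⊕ w ⊗ l) ⊕ (⊖ c ⊕ w ⊗ ⊖ b)      ≡⟨ cong (λ z → (c ⊕ w ⊗ l) ⊕ (⊖ c ⊕ z)) (sym (-‿distribʳ-* w b)) ⟩
      (c ⊕ w ⊗ l) ⊕ (⊖ c ⊕ ⊖ (w ⊗ b))    ≡⟨ cong ((c ⊕ w ⊗ l) ⊕_) (sym (⊖-distrib-⊕ c (w ⊗ b))) ⟩
      (c ⊕ w ⊗ l) ⊕ ⊖ (c ⊕ w ⊗ b)        ∎
      where open ≡-Reasoning

  eval-+ : ∀ {n} (f g : Form n) α → eval (f +ᴸ g) α ≡ eval f α ⊕ eval g α
  eval-+ (lin [] k) (lin [] l) [] = refl
  eval-+ (lin (c ∷ cs) k) (lin (d ∷ ds) l) (b ∷ α) =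
    trans (cong ((c ⊕ d) ⊗ bit b ⊕_) (eval-+ (lin cs k) (lin ds l) α))
          (solve 5 (λ c d β x y → (c :+ d) :* β :+ (x :+ y) := (c :* β :+ x) :+ (d :* β :+ y)) refl
                 c d (bit b) (eval (lin cs k) α) (eval (lin ds l) α))

  eval-· : ∀ {n} w (f : Form n) α → eval (w ·ᴸ f) α ≡ w ⊗ eval f α
  eval-· w (lin [] k) [] = refl
  eval-· w (lin (c ∷ cs) k) (b ∷ α) =
    trans (cong ((w ⊗ c) ⊗ bit b ⊕_) (eval-· w (lin cs k) α))
          (solve 4 (λ w c β x → (w :* c) :* β :+ w :* x := w :* (c :* β :+ x)) refl w c (bit b) (eval (lin cs k) α))

  eval-zero-coefficient : ∀ {n} (cs : Vec Fp n) k b α → eval (lin (𝟘 ∷ cs) k) (b ∷ α) ≡ eval (lin cs k) α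
  eval-zero-coefficient cs k b α = trans (cong (_⊕ eval (lin cs k) α) (zeroˡ (bit b))) (⊕-identityˡ _)

  eval-cst : ∀ {n} c (α : Vec Bool n) → eval (cst c) α ≡ c
  eval-cst c [] = refl
  eval-cst c (b ∷ α) = trans (eval-zero-coefficient (replicate _ 𝟘) c b α) (eval-cst c α)

  eval-var : ∀ {n} (i : Fin n) α → eval (var i) α ≡ bit (lookup α i)
  eval-var {suc n} Fin.zero (b ∷ α) = begin
    eval (lin (𝟙 ∷ tabulate (λ _ → 𝟘)) 𝟘) (b ∷ α)  ≡⟨ cong (λ cs → eval (lin (𝟙 ∷ cs) 𝟘) (b ∷ α)) (tabulate-const n 𝟘) ⟩
    𝟙 ⊗ bit b ⊕ eval (cst 𝟘) α                      ≡⟨ cong₂ _⊕_ (⊗-identityˡ (bit b)) (eval-cst 𝟘 α) ⟩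
    bit b ⊕ 𝟘                                       ≡⟨ +-identityʳ (bit b) ⟩
    bit b                                           ∎
    where open ≡-Reasoning
  eval-var {suc n} (Fin.suc i) (b ∷ α) = begin
    eval (var (Fin.suc i)) (b ∷ α)  ≡⟨ cong (λ cs → eval (lin (𝟘 ∷ cs) 𝟘) (b ∷ α)) (VP.tabulate-cong indicator-suc) ⟩
    eval (lin (𝟘 ∷ coeffs (var i)) 𝟘) (b ∷ α)  ≡⟨ eval-zero-coefficient (coeffs (var i)) 𝟘 b α ⟩
    eval (var i) α                  ≡⟨ eval-var i α ⟩
    bit (lookup α i)                ∎
    where
    open ≡-Reasoning
    indicator-suc : ∀ j → (if ⌊ Fin.suc i FinP.≟ Fin.suc j ⌋ then 𝟙 else 𝟘) ≡ (if ⌊ i FinP.≟ j ⌋ then 𝟙 else 𝟘)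
    indicator-suc j with i FinP.≟ j
    ... | yes _ = refl
    ... | no _  = refl

  eval-update : ∀ {n} (cs : Vec Fp n) k i α b → lookup cs i ≡ 𝟘 → eval (lin cs k) (α [ i ]≔ b) ≡ eval (lin cs k) α
  eval-update (c ∷ cs) k Fin.zero    (a ∷ α) b refl =
    trans (eval-zero-coefficient cs k b α) (sym (eval-zero-coefficient cs k a α))
  eval-update (c ∷ cs) k (Fin.suc i) (a ∷ α) b eq = cong (c ⊗ bit a ⊕_) (eval-update cs k i α b eq)

  ∈-assignments : ∀ {n} (α : Vec Bool n) → α ∈ assignments n
  ∈-assignments [] = here refl
  ∈-assignments (b ∷ α) =
    ∈-concatMap⁺ (λ v → (false ∷ v) ∷ (true ∷ v) ∷ []) (Any.map (λ { refl → extend b }) (∈-assignments α))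
    where
    extend : ∀ b → (b ∷ α) ∈ (false ∷ α) ∷ (true ∷ α) ∷ []
    extend false = here refl
    extend true  = there (here refl)

  ∈-Im⁺ : ∀ {n} (f : Form n) α {b} → eval f α ≡ b → b ∈ Im f
  ∈-Im⁺ {n} f α eq = ∈-filter⁺ (λ b → any? (λ α → eval f α FinP.≟ b) (assignments n))
    (∈-allFin _) (lose (∈-assignments α) eq)

  ∈-Im⁻ : ∀ {n} (f : Form n) {b} → b ∈ Im f → Σ (Vec Bool n) λ α → eval f α ≡ b
  ∈-Im⁻ {n} f b∈ with ∈-filter⁻ (λ b → any? (λ α → eval f α FinP.≟ b) (assignments n)) {xs = allFin p} b∈
  ... | _ , satisfied with find satisfied
  ... | α , _ , eq = α , eq

  length-Im : ∀ {n} (f : Form n) → length (Im f) ≤ p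
  length-Im {n} f = subst (length (Im f) ≤_) (LP.length-tabulate (λ i → i))
    (LP.length-filter (λ b → any? (λ α → eval f α FinP.≟ b) (assignments n)) (allFin p))

  bit-∈-Im-var : ∀ {n} (i : Fin n) b → bit b ∈ Im (var i)
  bit-∈-Im-var {n} i b = ∈-Im⁺ (var i) (replicate n false [ i ]≔ b)
    (trans (eval-var i _) (cong bit (VP.lookup∘update i (replicate n false) b)))

  Im-cst : ∀ {n} c {b} → b ∈ Im {n} (cst c) → b ≡ c
  Im-cst c b∈ with ∈-Im⁻ (cst c) b∈
  ... | α , eq = trans (sym eq) (eval-cst c α)

  -- prefix v c k is the form c + v₀ x₀ + … + v₍ₖ₋₁₎ x₍ₖ₋₁₎.
  prefix : ∀ {n} → Vec Fp n → Fp → ℕ → Form n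
  prefix v c k = lin (tabulate λ j → if does (toℕ j <? k) then lookup v j else 𝟘) c

  prefix-zero : ∀ {n} (v : Vec Fp n) c → prefix v c 0 ≡ cst c
  prefix-zero {n} v c = cong (λ cs → lin cs c) (tabulate-const n 𝟘)

  prefix-full : ∀ {n} (v : Vec Fp n) c → prefix v c n ≡ lin v c
  prefix-full {n} v c = cong (λ cs → lin cs c) (trans
    (VP.tabulate-cong λ j → cong (λ t → if t then lookup v j else 𝟘) (dec-true (toℕ j <? n) (FinP.toℕ<n j)))
    (VP.tabulate∘lookup v))

  module _ {n} (v : Vec Fp n) (c : Fp) {k} (k<n : k < n) where
    private
      i = fromℕ< k<n
      w = lookup v i

    prefix-coefficient-k : lookup (coeffs (prefix v c k)) i ≡ 𝟘
    prefix-coefficient-k = trans (VP.lookup∘tabulate _ i)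
      (cong (λ t → if t then w else 𝟘)
        (dec-false (toℕ i <? k) (λ i<k → ℕP.n≮n k (subst (_< k) (FinP.toℕ-fromℕ< k<n) i<k))))

    prefix-suc : prefix v c (suc k) ≡ prefix v c k +ᴸ w ·ᴸ var i
    prefix-suc = cong₂ lin
      (sym (trans (cong (zipWith _⊕_ _) (sym (VP.tabulate-∘ (w ⊗_) _)))
           (trans (zipWith-tabulate _ _) (VP.tabulate-cong λ j → sym (pointwise j)))))
      (sym (trans (cong (c ⊕_) (zeroʳ w)) (+-identityʳ c)))
      where
      zipWith-tabulate : ∀ {m} (f g : Fin m → Fp) →
                         zipWith _⊕_ (tabulate f) (tabulate g) ≡ tabulate (λ j → f j ⊕ g j)
      zipWith-tabulate {zero}  f g = refl
      zipWith-tabulate {suc m} f g = cong (f Fin.zero ⊕ g Fin.zero ∷_) (zipWith-tabulate (f ∘ Fin.suc) (g ∘ Fin.suc))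
      pointwise : ∀ j → (if does (toℕ j <? suc k) then lookup v j else 𝟘)
                      ≡ (if does (toℕ j <? k) then lookup v j else 𝟘) ⊕ w ⊗ (if ⌊ i FinP.≟ j ⌋ then 𝟙 else 𝟘)
      pointwise j with ℕP.<-cmp (toℕ j) k | i FinP.≟ j
      ... | tri< j<k _ _ | no _
        rewrite dec-true (toℕ j <? suc k) (ℕP.m<n⇒m<1+n j<k) | dec-true (toℕ j <? k) j<k =
          sym (trans (cong (lookup v j ⊕_) (zeroʳ w)) (+-identityʳ _))
      ... | tri≈ j≮k _ _ | yes refl
        rewrite dec-true (toℕ i <? suc k) (ℕP.≤-reflexive (cong suc (FinP.toℕ-fromℕ< k<n)))
              | dec-false (toℕ i <? k) j≮k =
          sym (trans (⊕-identityˡ _) (*-identityʳ w))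
      ... | tri> j≮k _ k<j | no _
        rewrite dec-false (toℕ j <? suc k) (λ j<1+k → ℕP.<⇒≱ k<j (ℕP.≤-pred j<1+k))
              | dec-false (toℕ j <? k) j≮k =
          sym (trans (⊕-identityˡ _) (zeroʳ w))
      ... | tri< _ j≢k _ | yes refl = ⊥-elim (j≢k (FinP.toℕ-fromℕ< k<n))
      ... | tri> _ j≢k _ | yes refl = ⊥-elim (j≢k (FinP.toℕ-fromℕ< k<n))
      ... | tri≈ _ j≡k _ | no i≢j = ⊥-elim (i≢j (FinP.toℕ-injective (trans (FinP.toℕ-fromℕ< k<n) (sym j≡k))))

    ∈-Im-prefix-suc : ∀ {d} → d ∈ Im (prefix v c k) → ∀ b → d ⊕ w ⊗ bit b ∈ Im (prefix v c (suc k))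
    ∈-Im-prefix-suc d∈ b with ∈-Im⁻ (prefix v c k) d∈
    ... | α , refl = ∈-Im⁺ (prefix v c (suc k)) (α [ i ]≔ b) (begin
      eval (prefix v c (suc k)) (α [ i ]≔ b)                   ≡⟨ cong (λ f → eval f (α [ i ]≔ b)) prefix-suc ⟩
      eval (prefix v c k +ᴸ w ·ᴸ var i) (α [ i ]≔ b)           ≡⟨ eval-+ (prefix v c k) (w ·ᴸ var i) (α [ i ]≔ b) ⟩
      eval (prefix v c k) (α [ i ]≔ b) ⊕ eval (w ·ᴸ var i) (α [ i ]≔ b)
        ≡⟨ cong₂ _⊕_ (eval-update (coeffs (prefix v c k)) c i α b prefix-coefficient-k) (eval-· w (var i) (α [ i ]≔ b)) ⟩
      eval (prefix v c k) α ⊕ w ⊗ eval (var i) (α [ i ]≔ b)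
        ≡⟨ cong (λ y → eval (prefix v c k) α ⊕ w ⊗ y) (trans (eval-var i (α [ i ]≔ b)) (cong bit (VP.lookup∘update i α b))) ⟩
      eval (prefix v c k) α ⊕ w ⊗ bit b                        ∎)
      where open ≡-Reasoning

  c-∈-Im-prefix-zero : ∀ {n} (v : Vec Fp n) c → c ∈ Im (prefix v c 0)
  c-∈-Im-prefix-zero {n} v c = ∈-Im⁺ (prefix v c 0) (replicate n false)
    (trans (cong (λ f → eval f (replicate n false)) (prefix-zero v c)) (eval-cst c (replicate n false)))

  equations : ∀ {n} → Form n → List (Form n)
  equations h = L.map (h -ᶜ_) (allFin p)

  ∈-equations : ∀ {n} (h : Form n) d → h -ᶜ d ∈ equations h
  ∈-equations h d = ∈-map⁺ (h -ᶜ_) (∈-allFin d)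

  length-equations : ∀ {n} (h : Form n) → length (equations h) ≡ p
  length-equations h = trans (LP.length-map (h -ᶜ_) (allFin p)) (LP.length-tabulate (λ i → i))

  constants : ∀ {n} → List (Form n)
  constants = L.map cst (allFin p)

  ∈-constants : ∀ {n} a → cst {n} a ∈ constants
  ∈-constants a = ∈-map⁺ cst (∈-allFin a)

  length-constants : ∀ {n} → length (constants {n}) ≡ p
  length-constants = trans (LP.length-map cst (allFin p)) (LP.length-tabulate (λ i → i))

module Construction (p : ℕ) .{{_ : NonZero p}} {n : ℕ} (Φ : List (LClause p n)) (W : ℕ) where
  open Residues p
  open LinearForm p
  open DecMembership (_≟ᴸ_ {n}) using (_∈?_)

  Clause : Set
  Clause = LClause p n

  Derivation : List Clause → Set
  Derivation = LDerivation p Φ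

  Narrow : Clause → Set
  Narrow K = length K ≤ W

  _⊑_ : Clause → (Form n → Set) → Set
  Γ ⊑ P = ∀ x → x ∈ Γ → P x

  record Reach (π : List Clause) (P : Clause → Set) (m : ℕ) : Set where
    constructor reach
    field
      new        : List Clause
      derivation : Derivation (new ++ π)
      line       : Clause
      line∈      : line ∈ new ++ π
      property   : P line
      length≤    : length new ≤ m
      narrow     : All Narrow new

  stay : ∀ {π P Γ} → Derivation π → Γ ∈ π → P Γ → Reach π P 0
  stay d Γ∈ PΓ = reach [] d _ Γ∈ PΓ z≤n []

  relax : ∀ {π P Q m m′} → Reach π P m → m ≤ m′ → (∀ {Γ} → P Γ → Q Γ) → Reach π Q m′
  relax (reach new d Γ Γ∈ PΓ len nar) m≤m′ P⇒Q = reach new d Γ Γ∈ (P⇒Q PΓ) (ℕP.≤-trans len m≤m′) nar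

  bind : ∀ {π P Q m m′} → Reach π P m →
         (∀ {π′} → Derivation π′ → (∀ {x} → x ∈ π → x ∈ π′) → ∀ Γ → Γ ∈ π′ → P Γ → Reach π′ Q m′) →
         Reach π Q (m + m′)
  bind {π} {m = m} {m′} (reach new d Γ Γ∈ PΓ len nar) k with k d (∈-++⁺ʳ new) Γ Γ∈ PΓ
  ... | reach new′ d′ Γ′ Γ′∈ QΓ′ len′ nar′ =
    reach (new′ ++ new) (subst Derivation (sym (LP.++-assoc new′ new π)) d′) Γ′
      (subst (Γ′ ∈_) (sym (LP.++-assoc new′ new π)) Γ′∈) QΓ′
      (subst (_≤ m + m′) (sym (LP.length-++ new′)) (subst (_≤ m + m′) (ℕP.+-comm (length new) (length new′)) (ℕP.+-mono-≤ len len′)))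
      (AllP.++⁺ nar′ nar)

  emit : ∀ {π K} → Derivation π → LJustified p Φ π K → Narrow K → Reach π (_≡ K) 1
  emit d j nar = reach (_ ∷ []) (j ∷ d) _ (here refl) refl (s≤s z≤n) (nar ∷ [])

  ≈ₛ-refl : (K : Clause) → K ≈ₛ K
  ≈ₛ-refl K x = (λ x∈ → x∈) , (λ x∈ → x∈)

  remove : Form n → Clause → Clause
  remove ℓ = filter (λ x → ¬? (x ≟ᴸ ℓ))

  ∈-remove⁻ : ∀ {ℓ Γ x} → x ∈ remove ℓ Γ → x ∈ Γ × x ≢ ℓ
  ∈-remove⁻ {ℓ} {Γ} = ∈-filter⁻ (λ x → ¬? (x ≟ᴸ ℓ)) {xs = Γ}

  remove-≈ : ∀ {ℓ Γ} → ℓ ∈ Γ → Γ ≈ₛ (ℓ ∷ remove ℓ Γ)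
  remove-≈ {ℓ} {Γ} ℓ∈ x = to , from
    where
    to : x ∈ Γ → x ∈ ℓ ∷ remove ℓ Γ
    to x∈ with x ≟ᴸ ℓ
    ... | yes refl = here refl
    ... | no x≢ℓ   = there (∈-filter⁺ (λ x → ¬? (x ≟ᴸ ℓ)) x∈ x≢ℓ)
    from : x ∈ ℓ ∷ remove ℓ Γ → x ∈ Γ
    from (here refl) = ℓ∈
    from (there x∈)  = proj₁ (∈-remove⁻ x∈)

  length-remove : ∀ ℓ Γ → length (remove ℓ Γ) ≤ length Γ
  length-remove ℓ = LP.length-filter (λ x → ¬? (x ≟ᴸ ℓ))

  restrict : List (Form n) → Clause → Clause
  restrict U R = filter (_∈? R) U

  restrict-≈ : ∀ U R → R ⊑ (_∈ U) → restrict U R ≈ₛ R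
  restrict-≈ U R R⊑U x = (λ x∈ → proj₂ (∈-filter⁻ (_∈? R) {xs = U} x∈)) , (λ x∈ → ∈-filter⁺ (_∈? R) (R⊑U x x∈) x∈)

  length-restrict : ∀ U R → length (restrict U R) ≤ length U
  length-restrict U R = LP.length-filter (_∈? R) U

  -- Derived lines are stored as restrict U R for a universe U of at most W literals; this is what keeps
  -- every line narrow.
  combine : ∀ {π} → Derivation π → (U : List (Form n)) → length U ≤ W →
            (L₁ L₂ : Clause) (f g : Form n) (α β : Fp) → L₁ ∈ π → L₂ ∈ π → f ∈ L₁ → g ∈ L₂ →
            let R = (α ·ᴸ f) +ᴸ (β ·ᴸ g) ∷ remove f L₁ ++ remove g L₂ in
            R ⊑ (_∈ U) → Reach π (λ K → K ≈ₛ R × Narrow K) 1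
  combine d U U≤W L₁ L₂ f g α β L₁∈ L₂∈ f∈ g∈ R⊑U =
    relax (emit d (comb L₁ L₂ (remove f L₁) (remove g L₂) f g α β L₁∈ L₂∈ (remove-≈ f∈) (remove-≈ g∈) (restrict-≈ U _ R⊑U))
                  (ℕP.≤-trans (length-restrict U _) U≤W))
          ℕP.≤-refl λ { refl → restrict-≈ U _ R⊑U , ℕP.≤-trans (length-restrict U _) U≤W }

  simplify : ∀ {π K} → Derivation π → K ∈ π → (a : Fp) → a ≢ 𝟘 → cst a ∈ K → Narrow K →
             Reach π (_≡ remove (cst a) K) 1
  simplify {K = K} d K∈ a a≢𝟘 a∈ nar =
    emit d (simp K (remove (cst a) K) a a≢𝟘 K∈ (remove-≈ a∈) (≈ₛ-refl _)) (ℕP.≤-trans (length-remove (cst a) K) nar)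

  IsEq : Form n → List Fp → Form n → Set
  IsEq h V x = Σ Fp λ d → d ∈ V × x ≡ h -ᶜ d

  1+[1+2*m]≡2*[1+m] : ∀ m → 1 + (1 + 2 * m) ≡ 2 * suc m
  1+[1+2*m]≡2*[1+m] m = sym (cong suc (ℕP.+-suc m (m + 0)))

  2*m≤2*[1+m] : ∀ m → 2 * m ≤ 2 * suc m
  2*m≤2*[1+m] m = ℕP.*-monoʳ-≤ 2 (ℕP.n≤1+n m)

  -- Each equation h = d of the second line is cut against h = u of the first: the combination
  -- (h - u) - (h - d) is the nonzero constant d - u, which simplification then deletes.
  module Resolution (h : Form n) (u : Fp) (X : Form n → Set) (U : List (Form n)) (U≤W : length U ≤ W)
                    (X⊆U : ∀ x → X x → x ∈ U) (h⊆U : ∀ d → h -ᶜ d ∈ U) (cst⊆U : ∀ a → cst a ∈ U)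
                    (Γ₁ : Clause) (Γ₁⊑ : Γ₁ ⊑ λ x → X x ⊎ x ≡ h -ᶜ u) (hu∈Γ₁ : h -ᶜ u ∈ Γ₁) where

    resolve-against : (V : List Fp) → All (u ≢_) V → (Y : Form n → Set) → (∀ x → Y x → x ∈ U) →
                      ∀ {π} → Derivation π → Γ₁ ∈ π → (Γ₂ : Clause) → Γ₂ ∈ π → Γ₂ ⊑ (λ x → Y x ⊎ IsEq h V x) →
                      Reach π (_⊑ λ x → X x ⊎ Y x) (2 * length V)
    resolve-against [] _ Y Y⊆U d Γ₁∈ Γ₂ Γ₂∈ Γ₂⊑ = stay d Γ₂∈ λ x x∈ → only-Y (Γ₂⊑ x x∈)
      where
      only-Y : ∀ {x} → Y x ⊎ IsEq h [] x → X x ⊎ Y x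
      only-Y (inj₁ y) = inj₂ y
      only-Y (inj₂ (_ , () , _))
    resolve-against (d₀ ∷ V) (u≢d₀ ∷ u∉V) Y Y⊆U {π} d Γ₁∈ Γ₂ Γ₂∈ Γ₂⊑ with h -ᶜ d₀ ∈? Γ₂
    ... | no hd₀∉Γ₂ = relax (resolve-against V u∉V Y Y⊆U d Γ₁∈ Γ₂ Γ₂∈ Γ₂⊑′) (2*m≤2*[1+m] (length V)) λ P → P
      where
      Γ₂⊑′ : Γ₂ ⊑ λ x → Y x ⊎ IsEq h V x
      Γ₂⊑′ x x∈ with Γ₂⊑ x x∈
      ... | inj₁ y                      = inj₁ y
      ... | inj₂ (_ , here refl , refl) = ⊥-elim (hd₀∉Γ₂ x∈)
      ... | inj₂ (d′ , there d′∈ , eq)  = inj₂ (d′ , d′∈ , eq)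
    ... | yes hd₀∈Γ₂ = subst (Reach π (_⊑ λ x → X x ⊎ Y x)) (1+[1+2*m]≡2*[1+m] (length V))
      (bind (combine d U U≤W Γ₁ Γ₂ (h -ᶜ u) (h -ᶜ d₀) 𝟙 (⊖ 𝟙) Γ₁∈ Γ₂∈ hu∈Γ₁ hd₀∈Γ₂ R⊑U) λ d₂ inc₂ K₀ K₀∈ (K₀≈R , K₀-narrow) →
        bind (simplify d₂ K₀∈ a a≢𝟘 (proj₂ (K₀≈R (cst a)) (here (sym (shift-cancel h u d₀)))) K₀-narrow) λ d₃ inc₃ K₁ K₁∈ K₁≡ →
          relax (resolve-against V u∉V (λ x → X x ⊎ Y x) X∨Y⊆U d₃ (inc₃ (inc₂ Γ₁∈)) K₁ K₁∈
                                 (subst (_⊑ _) (sym K₁≡) (K₁⊑ K₀ K₀≈R)))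
                ℕP.≤-refl λ K⊑ x x∈ → absorb (K⊑ x x∈))
      where
      a = d₀ ⊕ ⊖ u
      a≢𝟘 : a ≢ 𝟘
      a≢𝟘 = difference≢𝟘 u≢d₀
      R = (𝟙 ·ᴸ (h -ᶜ u)) +ᴸ ((⊖ 𝟙) ·ᴸ (h -ᶜ d₀)) ∷ remove (h -ᶜ u) Γ₁ ++ remove (h -ᶜ d₀) Γ₂
      rest⊑ : ∀ x → x ∈ remove (h -ᶜ u) Γ₁ ++ remove (h -ᶜ d₀) Γ₂ → (X x ⊎ Y x) ⊎ IsEq h V x
      rest⊑ x x∈ with ∈-++⁻ (remove (h -ᶜ u) Γ₁) x∈
      ... | inj₁ x∈₁ with ∈-remove⁻ x∈₁
      ...   | x∈Γ₁ , x≢hu with Γ₁⊑ x x∈Γ₁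
      ...     | inj₁ xX = inj₁ (inj₁ xX)
      ...     | inj₂ eq = ⊥-elim (x≢hu eq)
      rest⊑ x x∈ | inj₂ x∈₂ with ∈-remove⁻ x∈₂
      ...   | x∈Γ₂ , x≢hd₀ with Γ₂⊑ x x∈Γ₂
      ...     | inj₁ y                        = inj₁ (inj₂ y)
      ...     | inj₂ (_ , here refl , eq)     = ⊥-elim (x≢hd₀ eq)
      ...     | inj₂ (d′ , there d′∈ , eq)    = inj₂ (d′ , d′∈ , eq)
      X∨Y⊆U : ∀ x → X x ⊎ Y x → x ∈ U
      X∨Y⊆U x (inj₁ xX) = X⊆U x xX
      X∨Y⊆U x (inj₂ y)  = Y⊆U x y
      R⊑U : R ⊑ (_∈ U)
      R⊑U x (here refl) = subst (_∈ U) (sym (shift-cancel h u d₀)) (cst⊆U a)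
      R⊑U x (there x∈) with rest⊑ x x∈
      ... | inj₁ xXY = X∨Y⊆U x xXY
      ... | inj₂ (d′ , _ , refl) = h⊆U d′
      K₁⊑ : ∀ K₀ → K₀ ≈ₛ R → remove (cst a) K₀ ⊑ λ x → (X x ⊎ Y x) ⊎ IsEq h V x
      K₁⊑ K₀ K₀≈R x x∈ with ∈-remove⁻ x∈
      ... | x∈K₀ , x≢a with proj₁ (K₀≈R x) x∈K₀
      ...   | here eq   = ⊥-elim (x≢a (trans eq (shift-cancel h u d₀)))
      ...   | there x∈′ = rest⊑ x x∈′
      absorb : ∀ {x} → X x ⊎ (X x ⊎ Y x) → X x ⊎ Y x
      absorb (inj₁ xX) = inj₁ xX
      absorb (inj₂ xXY) = xXY

  resolve : ∀ {π} (h : Form n) (u : Fp) (X Y : Form n → Set) (U : List (Form n)) → length U ≤ W →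
            (∀ x → X x → x ∈ U) → (∀ x → Y x → x ∈ U) → (∀ d → h -ᶜ d ∈ U) → (∀ a → cst a ∈ U) →
            (V : List Fp) → All (u ≢_) V → Derivation π → (Γ₁ Γ₂ : Clause) → Γ₁ ∈ π → Γ₂ ∈ π →
            Γ₁ ⊑ (λ x → X x ⊎ x ≡ h -ᶜ u) → Γ₂ ⊑ (λ x → Y x ⊎ IsEq h V x) →
            Reach π (_⊑ λ x → X x ⊎ Y x) (2 * length V)
  resolve h u X Y U U≤W X⊆U Y⊆U h⊆U cst⊆U V u∉V d Γ₁ Γ₂ Γ₁∈ Γ₂∈ Γ₁⊑ Γ₂⊑ with h -ᶜ u ∈? Γ₁
  ... | no hu∉Γ₁ = relax (stay d Γ₁∈ λ x x∈ → only-X x x∈ (Γ₁⊑ x x∈)) z≤n λ P → P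
    where
    only-X : ∀ x → x ∈ Γ₁ → X x ⊎ x ≡ h -ᶜ u → X x ⊎ Y x
    only-X x _  (inj₁ xX)  = inj₁ xX
    only-X x x∈ (inj₂ refl) = ⊥-elim (hu∉Γ₁ x∈)
  ... | yes hu∈Γ₁ = Resolution.resolve-against h u X U U≤W X⊆U h⊆U cst⊆U Γ₁ Γ₁⊑ hu∈Γ₁ V u∉V Y Y⊆U d Γ₁∈ Γ₂ Γ₂∈ Γ₂⊑

module ImageClause (p : ℕ) .{{_ : NonZero p}} {m : ℕ} (Φ : List (LClause p (suc m))) (W : ℕ) (2p+2≤W : 2 * p + 2 ≤ W) where
  open Residues p
  open LinearForm p
  open Construction p Φ W
  open DecMembership (_≟ᴸ_ {suc m}) using (_∈?_)

  ImageEq : Form (suc m) → Form (suc m) → Set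
  ImageEq h = IsEq h (Im h)

  boolAxiom : Fin (suc m) → Clause
  boolAxiom = LBoolAxiom p

  ∈-boolAxiom⁻ : ∀ {i x} → x ∈ boolAxiom i → x ≡ var i -ᶜ 𝟘 ⊎ x ≡ var i -ᶜ 𝟙
  ∈-boolAxiom⁻ (here eq)         = inj₁ eq
  ∈-boolAxiom⁻ (there (here eq)) = inj₂ eq

  emit-boolAxiom : ∀ {π} → Derivation π → (i : Fin (suc m)) → Reach π (_≡ boolAxiom i) 1
  emit-boolAxiom d i = emit d (bool i (≈ₛ-refl _)) (ℕP.≤-trans (ℕP.m≤n+m 2 (2 * p)) 2p+2≤W)

  universe : Form (suc m) → Form (suc m) → Fin (suc m) → List (Form (suc m))
  universe h h′ i = equations h ++ equations h′ ++ boolAxiom i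

  length-universe : ∀ h h′ i → length (universe h h′ i) ≤ W
  length-universe h h′ i = subst (_≤ W) (sym length≡) (subst (_≤ W) (2*p+2≡p+[p+2] p) 2p+2≤W)
    where
    length≡ : length (universe h h′ i) ≡ p + (p + 2)
    length≡ = trans (LP.length-++ (equations h))
      (cong₂ _+_ (length-equations h) (trans (LP.length-++ (equations h′)) (cong (_+ 2) (length-equations h′))))
    2*p+2≡p+[p+2] : ∀ q → 2 * q + 2 ≡ q + (q + 2)
    2*p+2≡p+[p+2] q = trans (cong (λ r → q + r + 2) (ℕP.+-identityʳ q)) (ℕP.+-assoc q q 2)

  -- The base case h = c + w x₀: combining the Boolean axiom of x₀ with itself (coefficients w and 0)
  -- turns x₀ = b into h = c + w b, first for b = 0 and then for b = 1.
  image-clause-one : (v : Vec Fp (suc m)) (c : Fp) → ∀ {π} → Derivation π → Reach π (_⊑ ImageEq (prefix v c 1)) 3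
  image-clause-one v c {π} d =
    bind (emit-boolAxiom d i) λ d₁ _ B B∈ B≡ →
      bind (combine d₁ U (length-universe h h i) (boolAxiom i) (boolAxiom i) x₀ x₀ w 𝟘
                    (subst (_∈ _) B≡ B∈) (subst (_∈ _) B≡ B∈) (here refl) (here refl) R₁⊑U) λ d₂ _ W₁ W₁∈ (W₁≈R₁ , _) →
        second-value d₂ W₁ W₁∈ W₁≈R₁
    where
    i = Fin.zero
    x = var {suc m} i
    w = lookup v i
    h = prefix v c 1
    x₀ = x -ᶜ 𝟘
    x₁ = x -ᶜ 𝟙
    U = universe h h i
    combination : ∀ b → (w ·ᴸ (x -ᶜ bit b)) +ᴸ (𝟘 ·ᴸ (x -ᶜ bit b)) ≡ h -ᶜ (c ⊕ w ⊗ bit b)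
    combination b = trans (shift-scale x c w (bit b))
      (cong (_-ᶜ (c ⊕ w ⊗ bit b)) (sym (trans (prefix-suc v c z<s) (cong (_+ᴸ w ·ᴸ x) (prefix-zero v c)))))
    value : ∀ b → c ⊕ w ⊗ bit b ∈ Im h
    value = ∈-Im-prefix-suc v c z<s (c-∈-Im-prefix-zero v c)
    h-∈U : ∀ b → h -ᶜ (c ⊕ w ⊗ bit b) ∈ U
    h-∈U b = ∈-++⁺ˡ (∈-equations h (c ⊕ w ⊗ bit b))
    R₁ = (w ·ᴸ x₀) +ᴸ (𝟘 ·ᴸ x₀) ∷ remove x₀ (boolAxiom i) ++ remove x₀ (boolAxiom i)
    R₁⊑U : R₁ ⊑ (_∈ U)
    R₁⊑U _ (here refl) = subst (_∈ U) (sym (combination false)) (h-∈U false)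
    R₁⊑U _ (there x∈)  = ∈-++⁺ʳ (equations h) (∈-++⁺ʳ (equations h)
                           (proj₁ (∈-remove⁻ {x₀} {boolAxiom i} (∈-++-self⁻ (remove x₀ (boolAxiom i)) x∈))))
    W₁⊑ : ∀ W₁ → W₁ ≈ₛ R₁ → W₁ ⊑ λ y → y ≡ h -ᶜ (c ⊕ w ⊗ 𝟘) ⊎ y ≡ x₁
    W₁⊑ W₁ W₁≈R₁ y y∈ with proj₁ (W₁≈R₁ y) y∈
    ... | here eq = inj₁ (trans eq (combination false))
    ... | there y∈′ with ∈-remove⁻ {x₀} {boolAxiom i} (∈-++-self⁻ (remove x₀ (boolAxiom i)) y∈′)
    ...   | y∈B , y≢x₀ with ∈-boolAxiom⁻ {i} y∈B
    ...     | inj₁ eq = ⊥-elim (y≢x₀ eq)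
    ...     | inj₂ eq = inj₂ eq
    second-value : ∀ {π₂} → Derivation π₂ → ∀ W₁ → W₁ ∈ π₂ → W₁ ≈ₛ R₁ → Reach π₂ (_⊑ ImageEq h) 1
    second-value d₂ W₁ W₁∈ W₁≈R₁ with x₁ ∈? W₁
    ... | no x₁∉W₁ = relax (stay d₂ W₁∈ W₁⊑Im) z≤n λ P → P
      where
      W₁⊑Im : W₁ ⊑ ImageEq h
      W₁⊑Im y y∈ with W₁⊑ W₁ W₁≈R₁ y y∈
      ... | inj₁ eq   = _ , value false , eq
      ... | inj₂ refl = ⊥-elim (x₁∉W₁ y∈)
    ... | yes x₁∈W₁ =
      relax (combine d₂ U (length-universe h h i) W₁ W₁ x₁ x₁ w 𝟘 W₁∈ W₁∈ x₁∈W₁ x₁∈W₁ R₂⊑U) ℕP.≤-refl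
            λ (W₂≈R₂ , _) → W₂⊑Im _ W₂≈R₂
      where
      R₂ = (w ·ᴸ x₁) +ᴸ (𝟘 ·ᴸ x₁) ∷ remove x₁ W₁ ++ remove x₁ W₁
      first : ∀ y → y ∈ remove x₁ W₁ → y ≡ h -ᶜ (c ⊕ w ⊗ 𝟘)
      first y y∈ with ∈-remove⁻ {x₁} {W₁} y∈
      ... | y∈W₁ , y≢x₁ with W₁⊑ W₁ W₁≈R₁ y y∈W₁
      ...   | inj₁ eq = eq
      ...   | inj₂ eq = ⊥-elim (y≢x₁ eq)
      R₂⊑U : R₂ ⊑ (_∈ U)
      R₂⊑U _ (here refl) = subst (_∈ U) (sym (combination true)) (h-∈U true)
      R₂⊑U y (there y∈)  = subst (_∈ U) (sym (first y (∈-++-self⁻ (remove x₁ W₁) y∈))) (h-∈U false)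
      W₂⊑Im : ∀ W₂ → W₂ ≈ₛ R₂ → W₂ ⊑ ImageEq h
      W₂⊑Im W₂ W₂≈R₂ y y∈ with proj₁ (W₂≈R₂ y) y∈
      ... | here eq   = _ , value true , trans eq (combination true)
      ... | there y∈′ = _ , value false , first y (∈-++-self⁻ (remove x₁ W₁) y∈′)

  -- From prefix k to prefix (k+1), h′ = h + w xₖ: each h = d of the current line is cut against the
  -- Boolean axiom of xₖ, first into h′ = d and then, through xₖ = 1, into h′ = d + w.
  module Step (v : Vec Fp (suc m)) (c : Fp) {k : ℕ} (k<n : k < suc m) where
    i = fromℕ< k<n
    x = var {suc m} i
    w = lookup v i
    h = prefix v c k
    h′ = prefix v c (suc k)
    x₀ = x -ᶜ 𝟘
    x₁ = x -ᶜ 𝟙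
    U = universe h h′ i

    combination : ∀ d b → (𝟙 ·ᴸ (h -ᶜ d)) +ᴸ (w ·ᴸ (x -ᶜ bit b)) ≡ h′ -ᶜ (d ⊕ w ⊗ bit b)
    combination d b = trans (shift-add-scaled h x d w (bit b)) (cong (_-ᶜ (d ⊕ w ⊗ bit b)) (sym (prefix-suc v c k<n)))

    Pending : List Fp → Form (suc m) → Set
    Pending ds y = Σ Fp (λ d → d ∈ Im h × d ∈ ds × y ≡ h -ᶜ d) ⊎ ImageEq h′ y

    Pending⊆U : ∀ ds y → Pending ds y → y ∈ U
    Pending⊆U ds y (inj₁ (d , _ , _ , refl)) = ∈-++⁺ˡ (∈-equations h d)
    Pending⊆U ds y (inj₂ (e , _ , refl))     = ∈-++⁺ʳ (equations h) (∈-++⁺ˡ (∈-equations h′ e))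

    process : (ds : List Fp) → All (_∈ Im h) ds → ∀ {π} → Derivation π → boolAxiom i ∈ π →
              (Γ : Clause) → Γ ∈ π → Γ ⊑ Pending ds → Reach π (_⊑ ImageEq h′) (2 * length ds)
    process [] _ d B∈ Γ Γ∈ Γ⊑ = stay d Γ∈ λ y y∈ → done (Γ⊑ y y∈)
      where
      done : ∀ {y} → Pending [] y → ImageEq h′ y
      done (inj₁ (_ , _ , () , _))
      done (inj₂ e) = e
    process (d₀ ∷ ds) (d₀∈Im ∷ ds∈Im) {π} d B∈ Γ Γ∈ Γ⊑ with h -ᶜ d₀ ∈? Γ
    ... | no hd₀∉Γ = relax (process ds ds∈Im d B∈ Γ Γ∈ Γ⊑′) (2*m≤2*[1+m] (length ds)) λ P → P
      where
      Γ⊑′ : Γ ⊑ Pending ds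
      Γ⊑′ y y∈ with Γ⊑ y y∈
      ... | inj₁ (_ , _ , here refl , refl)       = ⊥-elim (hd₀∉Γ y∈)
      ... | inj₁ (d′ , d′∈ , there d′∈ds , eq)   = inj₁ (d′ , d′∈ , d′∈ds , eq)
      ... | inj₂ e                               = inj₂ e
    ... | yes hd₀∈Γ = subst (Reach π (_⊑ ImageEq h′)) (1+[1+2*m]≡2*[1+m] (length ds))
        (bind (combine d U (length-universe h h′ i) Γ (boolAxiom i) (h -ᶜ d₀) x₀ 𝟙 w Γ∈ B∈ hd₀∈Γ (here refl) R₁⊑U)
          λ d₂ inc W₁ W₁∈ (W₁≈R₁ , _) → through-x₁ d₂ (inc B∈) (inc Γ∈) W₁ W₁∈ W₁≈R₁)
      where
      value : ∀ b → d₀ ⊕ w ⊗ bit b ∈ Im h′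
      value = ∈-Im-prefix-suc v c k<n d₀∈Im
      R₁ = (𝟙 ·ᴸ (h -ᶜ d₀)) +ᴸ (w ·ᴸ x₀) ∷ remove (h -ᶜ d₀) Γ ++ remove x₀ (boolAxiom i)
      rest-Γ : ∀ y → y ∈ remove (h -ᶜ d₀) Γ → Pending ds y
      rest-Γ y y∈ with ∈-remove⁻ {h -ᶜ d₀} {Γ} y∈
      ... | y∈Γ , y≢hd₀ with Γ⊑ y y∈Γ
      ...   | inj₁ (_ , _ , here refl , eq)         = ⊥-elim (y≢hd₀ eq)
      ...   | inj₁ (d′ , d′∈ , there d′∈ds , eq)    = inj₁ (d′ , d′∈ , d′∈ds , eq)
      ...   | inj₂ e                                = inj₂ e
      rest-B : ∀ y → y ∈ remove x₀ (boolAxiom i) → y ≡ x₁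
      rest-B y y∈ with ∈-remove⁻ {x₀} {boolAxiom i} y∈
      ... | y∈B , y≢x₀ with ∈-boolAxiom⁻ {i} y∈B
      ...   | inj₁ eq = ⊥-elim (y≢x₀ eq)
      ...   | inj₂ eq = eq
      R₁⊑U : R₁ ⊑ (_∈ U)
      R₁⊑U _ (here refl) = subst (_∈ U) (sym (combination d₀ false)) (Pending⊆U [] _ (inj₂ (_ , value false , refl)))
      R₁⊑U y (there y∈) with ∈-++⁻ (remove (h -ᶜ d₀) Γ) y∈
      ... | inj₁ y∈Γ = Pending⊆U ds y (rest-Γ y y∈Γ)
      ... | inj₂ y∈B = ∈-++⁺ʳ (equations h) (∈-++⁺ʳ (equations h′) (proj₁ (∈-remove⁻ {x₀} {boolAxiom i} y∈B)))
      W₁⊑ : ∀ W₁ → W₁ ≈ₛ R₁ → W₁ ⊑ λ y → Pending ds y ⊎ y ≡ x₁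
      W₁⊑ W₁ W₁≈R₁ y y∈ with proj₁ (W₁≈R₁ y) y∈
      ... | here eq = inj₁ (inj₂ (_ , value false , trans eq (combination d₀ false)))
      ... | there y∈′ with ∈-++⁻ (remove (h -ᶜ d₀) Γ) y∈′
      ...   | inj₁ y∈Γ = inj₁ (rest-Γ y y∈Γ)
      ...   | inj₂ y∈B = inj₂ (rest-B y y∈B)
      through-x₁ : ∀ {π₂} → Derivation π₂ → boolAxiom i ∈ π₂ → Γ ∈ π₂ → ∀ W₁ → W₁ ∈ π₂ → W₁ ≈ₛ R₁ →
                   Reach π₂ (_⊑ ImageEq h′) (1 + 2 * length ds)
      through-x₁ d₂ B∈₂ Γ∈₂ W₁ W₁∈ W₁≈R₁ with x₁ ∈? W₁
      ... | no x₁∉W₁ = relax (process ds ds∈Im d₂ B∈₂ W₁ W₁∈ W₁⊑′) (ℕP.n≤1+n _) λ P → P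
        where
        W₁⊑′ : W₁ ⊑ Pending ds
        W₁⊑′ y y∈ with W₁⊑ W₁ W₁≈R₁ y y∈
        ... | inj₁ e    = e
        ... | inj₂ refl = ⊥-elim (x₁∉W₁ y∈)
      ... | yes x₁∈W₁ =
        bind (combine d₂ U (length-universe h h′ i) Γ W₁ (h -ᶜ d₀) x₁ 𝟙 w Γ∈₂ W₁∈ hd₀∈Γ x₁∈W₁ R₂⊑U)
          λ d₃ inc₃ W₂ W₂∈ (W₂≈R₂ , _) → process ds ds∈Im d₃ (inc₃ B∈₂) W₂ W₂∈ (W₂⊑ W₂ W₂≈R₂)
        where
        R₂ = (𝟙 ·ᴸ (h -ᶜ d₀)) +ᴸ (w ·ᴸ x₁) ∷ remove (h -ᶜ d₀) Γ ++ remove x₁ W₁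
        rest-W₁ : ∀ y → y ∈ remove x₁ W₁ → Pending ds y
        rest-W₁ y y∈ with ∈-remove⁻ {x₁} {W₁} y∈
        ... | y∈W₁ , y≢x₁ with W₁⊑ W₁ W₁≈R₁ y y∈W₁
        ...   | inj₁ e  = e
        ...   | inj₂ eq = ⊥-elim (y≢x₁ eq)
        R₂⊑U : R₂ ⊑ (_∈ U)
        R₂⊑U _ (here refl) = subst (_∈ U) (sym (combination d₀ true)) (Pending⊆U [] _ (inj₂ (_ , value true , refl)))
        R₂⊑U y (there y∈) with ∈-++⁻ (remove (h -ᶜ d₀) Γ) y∈
        ... | inj₁ y∈Γ  = Pending⊆U ds y (rest-Γ y y∈Γ)
        ... | inj₂ y∈W₁ = Pending⊆U ds y (rest-W₁ y y∈W₁)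
        W₂⊑ : ∀ W₂ → W₂ ≈ₛ R₂ → W₂ ⊑ Pending ds
        W₂⊑ W₂ W₂≈R₂ y y∈ with proj₁ (W₂≈R₂ y) y∈
        ... | here eq = inj₂ (_ , value true , trans eq (combination d₀ true))
        ... | there y∈′ with ∈-++⁻ (remove (h -ᶜ d₀) Γ) y∈′
        ...   | inj₁ y∈Γ  = rest-Γ y y∈Γ
        ...   | inj₂ y∈W₁ = rest-W₁ y y∈W₁

  image-clause-step : (v : Vec Fp (suc m)) (c : Fp) {k : ℕ} (k<n : k < suc m) → ∀ {π} → Derivation π →
                      (Γ : Clause) → Γ ∈ π → Γ ⊑ ImageEq (prefix v c k) →
                      Reach π (_⊑ ImageEq (prefix v c (suc k))) (1 + 2 * p)
  image-clause-step v c k<n d Γ Γ∈ Γ⊑ =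
    relax (bind (emit-boolAxiom d i) λ d₂ inc B B∈ B≡ →
             process (Im h) (All.tabulate λ e → e) d₂ (subst (_∈ _) B≡ B∈) Γ (inc Γ∈) λ y y∈ → pending (Γ⊑ y y∈))
          (s≤s (ℕP.*-monoʳ-≤ 2 (length-Im h))) λ P → P
    where
    open Step v c k<n
    pending : ∀ {y} → ImageEq h y → Pending (Im h) y
    pending (e , e∈ , eq) = inj₁ (e , e∈ , e∈ , eq)

  image-clause-prefix : (v : Vec Fp (suc m)) (c : Fp) → ∀ k → k < suc m → ∀ {π} → Derivation π →
                        Reach π (_⊑ ImageEq (prefix v c (suc k))) (3 + k * (1 + 2 * p))
  image-clause-prefix v c zero    _     d = image-clause-one v c d
  image-clause-prefix v c (suc k) 1+k<n {π} d =
    subst (Reach π (_⊑ ImageEq (prefix v c (2 + k)))) (trans (ℕP.+-assoc 3 (k * q) q) (cong (3 +_) (ℕP.+-comm (k * q) q)))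
      (bind (image-clause-prefix v c k (ℕP.<-trans (ℕP.n<1+n k) 1+k<n) d) λ d₂ _ Γ Γ∈ Γ⊑ →
        image-clause-step v c 1+k<n d₂ Γ Γ∈ Γ⊑)
    where q = 1 + 2 * p

  image-clause : (h : Form (suc m)) → ∀ {π} → Derivation π → Reach π (_⊑ ImageEq h) (3 + m * (1 + 2 * p))
  image-clause (lin v c) {π} d = subst (λ h → Reach π (_⊑ ImageEq h) _) (prefix-full v c) (image-clause-prefix v c m (ℕP.n<1+n m) d)

module Translation (p : ℕ) .{{_ : NonZero p}} {n : ℕ} where
  open Residues p
  open LinearForm p

  ⟨_⟩ : NClause p n → LClause p n
  ⟨_⟩ = transClause p

  ∈-transLit⁻ : ∀ {f : Form n} {a x} → x ∈ transLit p (f , a) → Σ Fp λ b → b ∈ Im f × b ≢ a × x ≡ f -ᶜ b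
  ∈-transLit⁻ {f} {a} x∈ with ∈-map∘filter⁻ (eqLit p f) (λ b → ¬? (b FinP.≟ a)) {xs = Im f} x∈
  ... | b , b∈ , eq , b≢a = b , b∈ , b≢a , eq

  ∈-transLit⁺ : ∀ {f : Form n} {a b} → b ∈ Im f → b ≢ a → f -ᶜ b ∈ transLit p (f , a)
  ∈-transLit⁺ {f} {a} b∈ b≢a = ∈-map∘filter⁺ (eqLit p f) (λ b → ¬? (b FinP.≟ a)) {xs = Im f} (_ , b∈ , refl , b≢a)

  ∈-⟨⟩⁻ : ∀ {K x} → x ∈ ⟨ K ⟩ → Σ (NLit p n) λ l → l ∈ K × x ∈ transLit p l
  ∈-⟨⟩⁻ {K} x∈ with ∈-concat⁻′ (L.map (transLit p) K) x∈
  ... | _ , x∈xs , xs∈ with ∈-map⁻ (transLit p) xs∈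
  ...   | l , l∈ , refl = l , l∈ , x∈xs

  ∈-⟨⟩⁺ : ∀ {K l x} → l ∈ K → x ∈ transLit p l → x ∈ ⟨ K ⟩
  ∈-⟨⟩⁺ l∈ x∈ = ∈-concat⁺′ x∈ (∈-map⁺ (transLit p) l∈)

  ⟨⟩-mono : ∀ {K K′} → (∀ l → l ∈ K → l ∈ K′) → ∀ x → x ∈ ⟨ K ⟩ → x ∈ ⟨ K′ ⟩
  ⟨⟩-mono K⊆K′ x x∈ with ∈-⟨⟩⁻ x∈
  ... | l , l∈ , x∈l = ∈-⟨⟩⁺ (K⊆K′ l l∈) x∈l

  ⟨⟩-≈ₛ : ∀ {K K′} → K ≈ₛ K′ → ⟨ K ⟩ ≈ₛ ⟨ K′ ⟩
  ⟨⟩-≈ₛ K≈K′ x = ⟨⟩-mono (λ l → proj₁ (K≈K′ l)) x , ⟨⟩-mono (λ l → proj₂ (K≈K′ l)) x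

  length-transLit : ∀ (l : NLit p n) → length (transLit p l) ≤ p
  length-transLit (f , a) = begin
    length (L.map (eqLit p f) (filter (λ b → ¬? (b FinP.≟ a)) (Im f)))  ≡⟨ LP.length-map (eqLit p f) (filter (λ b → ¬? (b FinP.≟ a)) (Im f)) ⟩
    length (filter (λ b → ¬? (b FinP.≟ a)) (Im f))                      ≤⟨ LP.length-filter (λ b → ¬? (b FinP.≟ a)) (Im f) ⟩
    length (Im f)                                                       ≤⟨ length-Im f ⟩
    p                                                                   ∎
    where open ℕP.≤-Reasoning

  length-⟨⟩ : ∀ K → length ⟨ K ⟩ ≤ p * length K
  length-⟨⟩ [] = z≤n
  length-⟨⟩ (l ∷ K) = begin
    length (transLit p l ++ ⟨ K ⟩)         ≡⟨ LP.length-++ (transLit p l) ⟩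
    length (transLit p l) + length ⟨ K ⟩   ≤⟨ ℕP.+-mono-≤ (length-transLit l) (length-⟨⟩ K) ⟩
    p + p * length K                       ≡⟨ ℕP.*-suc p (length K) ⟨
    p * suc (length K)                     ∎
    where open ℕP.≤-Reasoning

-- Every line of the simulation is a subclause of ⟨K⟩ (at most p S literals) or is assembled from one
-- together with at most three families of p equations h = d, which is where W comes from.
module Simulation (p : ℕ) .{{_ : NonZero p}} (1<p : 1 < p) {n : ℕ} (Φ : List (NClause p n)) (S : ℕ) where
  open Residues p
  open LinearForm p
  open Translation p {n}

  W : ℕ
  W = p * S + 4 * p + 2

  open Construction p (L.map ⟨_⟩ Φ) W public

  Simulates : List Clause → NClause p n → ℕ → Set
  Simulates π K m = Reach π (_⊑ (_∈ ⟨ K ⟩)) m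

  ⟨⟩-narrow : ∀ K → length K ≤ S → length ⟨ K ⟩ ≤ p * S
  ⟨⟩-narrow K K≤S = ℕP.≤-trans (length-⟨⟩ K) (ℕP.*-monoʳ-≤ p K≤S)

  universe-narrow : ∀ K (extra : List (Form n)) → length K ≤ S → length extra ≤ p + (p + p) →
                    length (⟨ K ⟩ ++ extra) ≤ W
  universe-narrow K extra K≤S extra≤ = begin
    length (⟨ K ⟩ ++ extra)           ≡⟨ LP.length-++ ⟨ K ⟩ ⟩
    length ⟨ K ⟩ + length extra       ≤⟨ ℕP.+-mono-≤ (⟨⟩-narrow K K≤S) extra≤ ⟩
    p * S + (p + (p + p))             ≤⟨ ℕP.+-monoʳ-≤ (p * S) (ℕP.+-monoʳ-≤ p (ℕP.+-monoʳ-≤ p (ℕP.m≤m+n p (p + 0)))) ⟩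
    p * S + 4 * p                     ≤⟨ ℕP.m≤m+n (p * S + 4 * p) 2 ⟩
    W                                 ∎
    where open ℕP.≤-Reasoning

  simulate-ax : ∀ {π K} → Derivation π → Any (K ≈ₛ_) Φ → length K ≤ S → Simulates π K 1
  simulate-ax {K = K} d K∈Φ K≤S =
    relax (emit d (ax (AnyP.map⁺ (Any.map ⟨⟩-≈ₛ K∈Φ))) (ℕP.≤-trans (⟨⟩-narrow K K≤S) (ℕP.≤-trans (ℕP.m≤m+n (p * S) (4 * p)) (ℕP.m≤m+n _ 2))))
          ℕP.≤-refl λ { refl x x∈ → x∈ }

  simulate-bool : ∀ {π K} → Derivation π → (i : Fin n) (k : Fp) → 2 ≤ toℕ k → K ≈ₛ ((var i , k) ∷ []) → Simulates π K 1
  simulate-bool {K = K} d i k 2≤k K≈ =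
    relax (emit d (bool i (≈ₛ-refl _)) (ℕP.m≤n+m 2 (p * S + 4 * p))) ℕP.≤-refl λ { refl x x∈ → axiom⊑ x x∈ }
    where
    toℕ-small : ∀ {j} → j < p → toℕ ⟦ j ⟧ ≡ j
    toℕ-small j<p = trans (toℕ-⟦⟧ _) (m<n⇒m%n≡m j<p)
    𝟘≢k : 𝟘 ≢ k
    𝟘≢k refl = ℕP.<⇒≱ z<s (subst (2 ≤_) (toℕ-small (ℕP.<-trans z<s 1<p)) 2≤k)
    𝟙≢k : 𝟙 ≢ k
    𝟙≢k refl = ℕP.<⇒≱ (s≤s z<s) (subst (2 ≤_) (toℕ-small 1<p) 2≤k)
    into-K : ∀ x → x ∈ transLit p (var i , k) → x ∈ ⟨ K ⟩
    into-K x x∈ = ⟨⟩-mono (λ l l∈ → proj₂ (K≈ l) l∈) x (∈-⟨⟩⁺ {(var i , k) ∷ []} (here refl) x∈)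
    axiom⊑ : LBoolAxiom p i ⊑ (_∈ ⟨ K ⟩)
    axiom⊑ x (here refl)         = into-K x (∈-transLit⁺ (bit-∈-Im-var i false) 𝟘≢k)
    axiom⊑ x (there (here refl)) = into-K x (∈-transLit⁺ (bit-∈-Im-var i true) 𝟙≢k)

  -- ⟨0 ≠ 0⟩ is empty, so a line simulating C ∨ 0 ≠ 0 already simulates C.
  simulate-simp : ∀ {π K L C} → Derivation π → (Γ : Clause) → Γ ∈ π → Γ ⊑ (_∈ ⟨ L ⟩) →
                  L ≈ₛ ((cst 𝟘 , 𝟘) ∷ C) → K ≈ₛ C → Simulates π K 0
  simulate-simp {K = K} {L} d Γ Γ∈ Γ⊑ L≈ K≈ = stay d Γ∈ Γ⊑⟨K⟩
    where
    Γ⊑⟨K⟩ : Γ ⊑ (_∈ ⟨ K ⟩)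
    Γ⊑⟨K⟩ x x∈ with ∈-⟨⟩⁻ {L} (Γ⊑ x x∈)
    ... | l , l∈ , x∈l with proj₁ (L≈ l) l∈
    ...   | here refl with ∈-transLit⁻ {cst 𝟘} {𝟘} x∈l
    ...     | b , b∈ , b≢𝟘 , _ = ⊥-elim (b≢𝟘 (Im-cst 𝟘 b∈))
    Γ⊑⟨K⟩ x x∈ | l , l∈ , x∈l | there l∈C = proj₂ (⟨⟩-≈ₛ K≈ x) (∈-⟨⟩⁺ l∈C x∈l)

  -- The premise for value d supplies f = b for b ≠ d, so resolving against it removes f = d from the
  -- running line; after all values of f only literals of ⟨K⟩ remain.
  module ResolutionRule {K : NClause p n} (K≤S : length K ≤ S) (f : Form n) (Lᶠ Cᶠ : Fp → NClause p n)
                        (Lᶠ≈ : ∀ j → Lᶠ j ≈ₛ ((f , j) ∷ Cᶠ j)) (K≈ : K ≈ₛ concat (L.map Cᶠ (allFin p))) where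
    InK : Form n → Set
    InK x = x ∈ ⟨ K ⟩

    U : List (Form n)
    U = ⟨ K ⟩ ++ equations f ++ constants

    U≤W : length U ≤ W
    U≤W = universe-narrow K _ K≤S
      (ℕP.≤-trans (ℕP.≤-reflexive (length-++-≡ (equations f) constants (length-equations f) length-constants)) (ℕP.m≤n+m (p + p) p))

    InK⊆U : ∀ x → InK x → x ∈ U
    InK⊆U x = ∈-++⁺ˡ

    f⊆U : ∀ d → f -ᶜ d ∈ U
    f⊆U d = ∈-++⁺ʳ ⟨ K ⟩ (∈-++⁺ˡ (∈-equations f d))

    cst⊆U : ∀ a → cst a ∈ U
    cst⊆U a = ∈-++⁺ʳ ⟨ K ⟩ (∈-++⁺ʳ (equations f) (∈-constants a))

    premise⊑ : ∀ j (Γ : Clause) → Γ ⊑ (_∈ ⟨ Lᶠ j ⟩) → Γ ⊑ λ x → InK x ⊎ Σ Fp (λ b → b ∈ Im f × b ≢ j × x ≡ f -ᶜ b)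
    premise⊑ j Γ Γ⊑ x x∈ with ∈-⟨⟩⁻ {Lᶠ j} (Γ⊑ x x∈)
    ... | l , l∈ , x∈l with proj₁ (Lᶠ≈ j l) l∈
    ...   | here refl = inj₂ (∈-transLit⁻ {f} {j} x∈l)
    ...   | there l∈C =
      inj₁ (proj₂ (⟨⟩-≈ₛ K≈ x) (⟨⟩-mono (λ l l∈ → ∈-concat⁺′ l∈ (∈-map⁺ Cᶠ (∈-allFin j))) x (∈-⟨⟩⁺ l∈C x∈l)))

    others : Fp → List Fp
    others d = filter (λ b → ¬? (b FinP.≟ d)) (Im f)

    d∉others : ∀ d → All (d ≢_) (others d)
    d∉others d = All.tabulate λ b∈ d≡b → proj₂ (∈-filter⁻ (λ b → ¬? (b FinP.≟ d)) {xs = Im f} b∈) (sym d≡b)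

    length-others : ∀ d → length (others d) ≤ p
    length-others d = ℕP.≤-trans (LP.length-filter (λ b → ¬? (b FinP.≟ d)) (Im f)) (length-Im f)

    Premises : List Clause → Set
    Premises π = ∀ j → Σ Clause λ Γ → Γ ∈ π × Γ ⊑ (_∈ ⟨ Lᶠ j ⟩)

    Pending : List Fp → Form n → Set
    Pending ds x = InK x ⊎ IsEq f ds x

    process : (ds : List Fp) → ∀ {π} → Derivation π → Premises π → (Γ : Clause) → Γ ∈ π → Γ ⊑ Pending ds →
              Reach π (_⊑ InK) (length ds * (2 * p))
    process [] d _ Γ Γ∈ Γ⊑ = stay d Γ∈ λ x x∈ → done (Γ⊑ x x∈)
      where
      done : ∀ {x} → Pending [] x → InK x
      done (inj₁ x∈K) = x∈K
      done (inj₂ (_ , () , _))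
    process (d₀ ∷ ds) d premises Γ Γ∈ Γ⊑ with premises d₀
    ... | Γ₀ , Γ₀∈ , Γ₀⊑ =
      bind (relax (resolve f d₀ (Pending ds) InK U U≤W Pending⊆U InK⊆U f⊆U cst⊆U (others d₀) (d∉others d₀)
                          d Γ Γ₀ Γ∈ Γ₀∈ Γ⊑′ Γ₀⊑′)
                  (ℕP.*-monoʳ-≤ 2 (length-others d₀)) λ P → P)
        λ d₂ inc Γ′ Γ′∈ Γ′⊑ → process ds d₂ (λ j → let Γⱼ , Γⱼ∈ , Γⱼ⊑ = premises j in Γⱼ , inc Γⱼ∈ , Γⱼ⊑) Γ′ Γ′∈
                                (λ x x∈ → merge (Γ′⊑ x x∈))
      where
      Pending⊆U : ∀ x → Pending ds x → x ∈ U
      Pending⊆U x (inj₁ x∈K)          = InK⊆U x x∈K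
      Pending⊆U x (inj₂ (b , _ , refl)) = f⊆U b
      Γ⊑′ : Γ ⊑ λ x → Pending ds x ⊎ x ≡ f -ᶜ d₀
      Γ⊑′ x x∈ with Γ⊑ x x∈
      ... | inj₁ x∈K                   = inj₁ (inj₁ x∈K)
      ... | inj₂ (_ , here refl , eq)  = inj₂ eq
      ... | inj₂ (b , there b∈ , eq)   = inj₁ (inj₂ (b , b∈ , eq))
      Γ₀⊑′ : Γ₀ ⊑ λ x → InK x ⊎ IsEq f (others d₀) x
      Γ₀⊑′ x x∈ with premise⊑ d₀ Γ₀ Γ₀⊑ x x∈
      ... | inj₁ x∈K                 = inj₁ x∈K
      ... | inj₂ (b , b∈ , b≢d₀ , eq) = inj₂ (b , ∈-filter⁺ (λ b → ¬? (b FinP.≟ d₀)) b∈ b≢d₀ , eq)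
      merge : ∀ {x} → Pending ds x ⊎ InK x → Pending ds x
      merge (inj₁ x⊑) = x⊑
      merge (inj₂ x∈K) = inj₁ x∈K

    simulate : ∀ {π} → Derivation π → Premises π → Simulates π K (p * (2 * p))
    simulate d premises with premises 𝟘
    ... | Γ₀ , Γ₀∈ , Γ₀⊑ = relax (process (Im f) d premises Γ₀ Γ₀∈ Γ₀⊑′) (ℕP.*-monoˡ-≤ (2 * p) (length-Im f)) λ P → P
      where
      Γ₀⊑′ : Γ₀ ⊑ Pending (Im f)
      Γ₀⊑′ x x∈ with premise⊑ 𝟘 Γ₀ Γ₀⊑ x x∈
      ... | inj₁ x∈K              = inj₁ x∈K
      ... | inj₂ (b , b∈ , _ , eq) = inj₂ (b , b∈ , eq)

  LcombSimulation : ℕ → Set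
  LcombSimulation m = ∀ {π K L C} → Derivation π → length K ≤ S → (f g : Form n) (a b : Fp) →
    (Γ : Clause) → Γ ∈ π → Γ ⊑ (_∈ ⟨ L ⟩) → L ≈ₛ ((f , a) ∷ C) →
    K ≈ₛ (C ++ (f +ᴸ g , a ⊕ b) ∷ (g , b) ∷ []) → Simulates π K m

  module LinearCombinationRule {K L C : NClause p n} (f g : Form n) (a b : Fp)
                               (L≈ : L ≈ₛ ((f , a) ∷ C)) (K≈ : K ≈ₛ (C ++ (f +ᴸ g , a ⊕ b) ∷ (g , b) ∷ [])) where
    InK : Form n → Set
    InK x = x ∈ ⟨ K ⟩

    private
      into-K : ∀ {l x} → l ∈ C ++ (f +ᴸ g , a ⊕ b) ∷ (g , b) ∷ [] → x ∈ transLit p l → InK x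
      into-K l∈ x∈ = proj₂ (⟨⟩-≈ₛ K≈ _) (∈-⟨⟩⁺ l∈ x∈)

    g-eq-∈K : ∀ e → e ∈ Im g → e ≢ b → InK (g -ᶜ e)
    g-eq-∈K e e∈ e≢b = into-K (∈-++⁺ʳ C (there (here refl))) (∈-transLit⁺ e∈ e≢b)

    sum-eq-∈K : ∀ e → e ∈ Im (f +ᴸ g) → e ≢ a ⊕ b → InK ((f +ᴸ g) -ᶜ e)
    sum-eq-∈K e e∈ e≢a+b = into-K (∈-++⁺ʳ C (here refl)) (∈-transLit⁺ e∈ e≢a+b)

    premise⊑ : (Γ : Clause) → Γ ⊑ (_∈ ⟨ L ⟩) → Γ ⊑ λ x → InK x ⊎ Σ Fp (λ c → c ∈ Im f × c ≢ a × x ≡ f -ᶜ c)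
    premise⊑ Γ Γ⊑ x x∈ with ∈-⟨⟩⁻ {L} (Γ⊑ x x∈)
    ... | l , l∈ , x∈l with proj₁ (L≈ l) l∈
    ...   | here refl = inj₂ (∈-transLit⁻ {f} {a} x∈l)
    ...   | there l∈C = inj₁ (into-K (∈-++⁺ˡ l∈C) x∈l)

-- Without variables f and g are constants, and every literal f = c of the premise is already the
-- trivial equation 0 = 0 occurring in ⟨K⟩.
simulate-lcomb-closed : ∀ p .{{_ : NonZero p}} (1<p : 1 < p) (Φ : List (NClause p 0)) S →
                        Simulation.LcombSimulation p 1<p Φ S 0
simulate-lcomb-closed p 1<p Φ S {π} {K} {L} {C} d _ (lin [] k) (lin [] l) a b Γ Γ∈ Γ⊑ L≈ K≈ = stay d Γ∈ Γ⊑K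
  where
  open Residues p
  open LinearForm p
  open Simulation p 1<p Φ S
  open LinearCombinationRule {K} {L} {C} (lin [] k) (lin [] l) a b L≈ K≈
  trivial : ∀ e → lin {p} [] (e ⊕ ⊖ e) ≡ lin [] 𝟘
  trivial e = cong (lin []) (-‿inverseʳ e)
  Γ⊑K : Γ ⊑ InK
  Γ⊑K x x∈ with premise⊑ Γ Γ⊑ x x∈
  ... | inj₁ x∈K = x∈K
  ... | inj₂ (c , c∈ , c≢a , refl) with ∈-Im⁻ (lin [] k) c∈
  ...   | [] , refl with l FinP.≟ b
  ...     | no l≢b   = subst InK (trans (trivial l) (sym (trivial k))) (g-eq-∈K l (∈-Im⁺ (lin [] l) [] refl) l≢b)
  ...     | yes refl = subst InK (trans (trivial (k ⊕ l)) (sym (trivial k)))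
                         (sum-eq-∈K (k ⊕ l) (∈-Im⁺ (lin [] k +ᴸ lin [] l) [] refl) λ eq → c≢a (∙-cancelʳ l k a eq))

-- With variables, first derive the image clauses of g and of f + g. Each literal f = c (c ≠ a) of the
-- premise is combined with g = b into f + g = c + b, where c + b ≠ a + b; if c + b is a value of f + g
-- this literal belongs to ⟨K⟩, otherwise it is resolved away against the image clause of f + g.
module LcombWithVariables (p : ℕ) .{{_ : NonZero p}} (1<p : 1 < p) {m : ℕ} (Φ : List (NClause p (suc m))) (S : ℕ) where
  open Residues p
  open LinearForm p
  open Translation p {suc m}
  open Simulation p 1<p Φ S
  open DecMembership (_≟ᴸ_ {suc m}) using (_∈?_)

  2p+2≤W : 2 * p + 2 ≤ W
  2p+2≤W = ℕP.+-monoˡ-≤ 2 (ℕP.≤-trans (ℕP.*-monoˡ-≤ p {2} {4} (s≤s (s≤s z≤n))) (ℕP.m≤n+m (4 * p) (p * S)))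

  open ImageClause p (L.map ⟨_⟩ Φ) W 2p+2≤W using (ImageEq; image-clause)

  image-lines : ℕ
  image-lines = 3 + m * (1 + 2 * p)

  simulate-lcomb : LcombSimulation (image-lines + (image-lines + p * (1 + 2 * p)))
  simulate-lcomb {π} {K} {L} {C} d K≤S f g a b Γ Γ∈ Γ⊑ L≈ K≈ =
    bind (image-clause g d) λ d₂ inc Γg Γg∈ Γg⊑ → with-image-of-g d₂ (inc Γ∈) Γg Γg∈ Γg⊑
    where
    open LinearCombinationRule {K} {L} {C} f g a b L≈ K≈
    s = f +ᴸ g
    U = ⟨ K ⟩ ++ equations f ++ equations s ++ constants
    U≤W : length U ≤ W
    U≤W = universe-narrow K _ K≤S (ℕP.≤-reflexive
      (length-++-≡ (equations f) (equations s ++ constants) (length-equations f)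
        (length-++-≡ (equations s) constants (length-equations s) length-constants)))
    f⊆U : ∀ c → f -ᶜ c ∈ U
    f⊆U c = ∈-++⁺ʳ ⟨ K ⟩ (∈-++⁺ˡ (∈-equations f c))
    s⊆U : ∀ e → s -ᶜ e ∈ U
    s⊆U e = ∈-++⁺ʳ ⟨ K ⟩ (∈-++⁺ʳ (equations f) (∈-++⁺ˡ (∈-equations s e)))
    cst⊆U : ∀ e → cst e ∈ U
    cst⊆U e = ∈-++⁺ʳ ⟨ K ⟩ (∈-++⁺ʳ (equations f) (∈-++⁺ʳ (equations s) (∈-constants e)))

    Pending : List Fp → Form (suc m) → Set
    Pending cs x = InK x ⊎ Σ Fp (λ c → c ∈ cs × c ≢ a × x ≡ f -ᶜ c)

    Pending⊆U : ∀ cs x → Pending cs x → x ∈ U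
    Pending⊆U cs x (inj₁ x∈K)               = ∈-++⁺ˡ x∈K
    Pending⊆U cs x (inj₂ (c , _ , _ , refl)) = f⊆U c

    module Process (Γg : Clause) (Γg⊑ : Γg ⊑ ImageEq g) (gb∈Γg : g -ᶜ b ∈ Γg) (Γs : Clause) (Γs⊑ : Γs ⊑ ImageEq s) where
      process : (cs : List Fp) → ∀ {π} → Derivation π → Γg ∈ π → Γs ∈ π → (Γ : Clause) → Γ ∈ π → Γ ⊑ Pending cs →
                Reach π (_⊑ InK) (length cs * (1 + 2 * p))
      process [] d _ _ Γ Γ∈ Γ⊑ = stay d Γ∈ λ x x∈ → done (Γ⊑ x x∈)
        where
        done : ∀ {x} → Pending [] x → InK x
        done (inj₁ x∈K) = x∈K
        done (inj₂ (_ , () , _))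
      process (c ∷ cs) d Γg∈ Γs∈ Γ Γ∈ Γ⊑ with c FinP.≟ a | f -ᶜ c ∈? Γ
      ... | yes refl | _ = relax (process cs d Γg∈ Γs∈ Γ Γ∈ Γ⊑′) (ℕP.m≤n+m _ (1 + 2 * p)) λ P → P
        where
        Γ⊑′ : Γ ⊑ Pending cs
        Γ⊑′ x x∈ with Γ⊑ x x∈
        ... | inj₁ x∈K                         = inj₁ x∈K
        ... | inj₂ (_ , here refl , c≢c , _)   = ⊥-elim (c≢c refl)
        ... | inj₂ (c′ , there c′∈ , c′≢a , eq) = inj₂ (c′ , c′∈ , c′≢a , eq)
      ... | no _ | no fc∉Γ = relax (process cs d Γg∈ Γs∈ Γ Γ∈ Γ⊑′) (ℕP.m≤n+m _ (1 + 2 * p)) λ P → P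
        where
        Γ⊑′ : Γ ⊑ Pending cs
        Γ⊑′ x x∈ with Γ⊑ x x∈
        ... | inj₁ x∈K                         = inj₁ x∈K
        ... | inj₂ (_ , here refl , _ , refl)  = ⊥-elim (fc∉Γ x∈)
        ... | inj₂ (c′ , there c′∈ , c′≢a , eq) = inj₂ (c′ , c′∈ , c′≢a , eq)
      ... | no c≢a | yes fc∈Γ =
        bind (combine d U U≤W Γ Γg (f -ᶜ c) (g -ᶜ b) 𝟙 𝟙 Γ∈ Γg∈ fc∈Γ gb∈Γg R⊑U) λ d₂ inc K₀ K₀∈ (K₀≈R , _) →
          eliminate-sum d₂ (inc Γg∈) (inc Γs∈) K₀ K₀∈ (K₀⊑ K₀ K₀≈R)
        where
        u = c ⊕ b
        u≢a+b : u ≢ a ⊕ b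
        u≢a+b eq = c≢a (∙-cancelʳ b c a eq)
        R = (𝟙 ·ᴸ (f -ᶜ c)) +ᴸ (𝟙 ·ᴸ (g -ᶜ b)) ∷ remove (f -ᶜ c) Γ ++ remove (g -ᶜ b) Γg
        rest-Γ : ∀ x → x ∈ remove (f -ᶜ c) Γ → Pending cs x
        rest-Γ x x∈ with ∈-remove⁻ {f -ᶜ c} {Γ} x∈
        ... | x∈Γ , x≢fc with Γ⊑ x x∈Γ
        ...   | inj₁ x∈K                          = inj₁ x∈K
        ...   | inj₂ (_ , here refl , _ , eq)     = ⊥-elim (x≢fc eq)
        ...   | inj₂ (c′ , there c′∈ , c′≢a , eq) = inj₂ (c′ , c′∈ , c′≢a , eq)
        rest-Γg : ∀ x → x ∈ remove (g -ᶜ b) Γg → InK x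
        rest-Γg x x∈ with ∈-remove⁻ {g -ᶜ b} {Γg} x∈
        ... | x∈Γg , x≢gb with Γg⊑ x x∈Γg
        ...   | e , e∈ , refl with e FinP.≟ b
        ...     | yes refl = ⊥-elim (x≢gb refl)
        ...     | no e≢b   = g-eq-∈K e e∈ e≢b
        R⊑U : R ⊑ (_∈ U)
        R⊑U _ (here refl) = subst (_∈ U) (sym (shift-add f g c b)) (s⊆U u)
        R⊑U x (there x∈) with ∈-++⁻ (remove (f -ᶜ c) Γ) x∈
        ... | inj₁ x∈Γ  = Pending⊆U cs x (rest-Γ x x∈Γ)
        ... | inj₂ x∈Γg = ∈-++⁺ˡ (rest-Γg x x∈Γg)
        K₀⊑ : ∀ K₀ → K₀ ≈ₛ R → K₀ ⊑ λ x → Pending cs x ⊎ x ≡ s -ᶜ u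
        K₀⊑ K₀ K₀≈R x x∈ with proj₁ (K₀≈R x) x∈
        ... | here eq = inj₂ (trans eq (shift-add f g c b))
        ... | there x∈′ with ∈-++⁻ (remove (f -ᶜ c) Γ) x∈′
        ...   | inj₁ x∈Γ  = inj₁ (rest-Γ x x∈Γ)
        ...   | inj₂ x∈Γg = inj₁ (inj₁ (rest-Γg x x∈Γg))
        eliminate-sum : ∀ {π₂} → Derivation π₂ → Γg ∈ π₂ → Γs ∈ π₂ → (K₀ : Clause) → K₀ ∈ π₂ →
                        K₀ ⊑ (λ x → Pending cs x ⊎ x ≡ s -ᶜ u) → Reach π₂ (_⊑ InK) (2 * p + length cs * (1 + 2 * p))
        eliminate-sum d₂ Γg∈₂ Γs∈₂ K₀ K₀∈ K₀⊑′ with any? (u FinP.≟_) (Im s)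
        ... | yes u∈Im = relax (process cs d₂ Γg∈₂ Γs∈₂ K₀ K₀∈ K₀⊑″) (ℕP.m≤n+m _ (2 * p)) λ P → P
          where
          K₀⊑″ : K₀ ⊑ Pending cs
          K₀⊑″ x x∈ with K₀⊑′ x x∈
          ... | inj₁ x⊑ = x⊑
          ... | inj₂ refl = inj₁ (sum-eq-∈K u u∈Im u≢a+b)
        ... | no u∉Im =
          bind (relax (resolve s u (Pending cs) (λ _ → ⊥) U U≤W (Pending⊆U cs) (λ _ ()) s⊆U cst⊆U (Im s)
                         (All.tabulate λ e∈ u≡e → u∉Im (subst (_∈ Im s) (sym u≡e) e∈)) d₂ K₀ Γs K₀∈ Γs∈₂ K₀⊑′
                         λ x x∈ → inj₂ (Γs⊑ x x∈))
                      (ℕP.*-monoʳ-≤ 2 (length-Im s)) λ P → P)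
            λ d₃ inc₃ Γ′ Γ′∈ Γ′⊑ → process cs d₃ (inc₃ Γg∈₂) (inc₃ Γs∈₂) Γ′ Γ′∈ λ x x∈ → drop-⊥ (Γ′⊑ x x∈)
          where
          drop-⊥ : ∀ {x} → Pending cs x ⊎ ⊥ → Pending cs x
          drop-⊥ (inj₁ x⊑) = x⊑

    with-image-of-g : ∀ {π₂} → Derivation π₂ → Γ ∈ π₂ → (Γg : Clause) → Γg ∈ π₂ → Γg ⊑ ImageEq g →
                      Simulates π₂ K (image-lines + p * (1 + 2 * p))
    with-image-of-g d₂ Γ∈₂ Γg Γg∈ Γg⊑ with g -ᶜ b ∈? Γg
    ... | no gb∉Γg = relax (stay d₂ Γg∈ Γg⊑K) z≤n λ P → P
      where
      Γg⊑K : Γg ⊑ InK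
      Γg⊑K x x∈ with Γg⊑ x x∈
      ... | e , e∈ , refl with e FinP.≟ b
      ...   | yes refl = ⊥-elim (gb∉Γg x∈)
      ...   | no e≢b   = g-eq-∈K e e∈ e≢b
    ... | yes gb∈Γg = bind (image-clause s d₂) λ d₃ inc₃ Γs Γs∈ Γs⊑ →
        relax (Process.process Γg Γg⊑ gb∈Γg Γs Γs⊑ (Im f) d₃ (inc₃ Γg∈) Γs∈ Γ (inc₃ Γ∈₂) Γ⊑′)
              (ℕP.*-monoˡ-≤ (1 + 2 * p) (length-Im f)) λ P → P
      where
      Γ⊑′ : Γ ⊑ Pending (Im f)
      Γ⊑′ x x∈ with premise⊑ Γ Γ⊑ x x∈
      ... | inj₁ x∈K = inj₁ x∈K
      ... | inj₂ (c , c∈ , c≢a , eq) = inj₂ (c , c∈ , c≢a , eq)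

module SimulateDerivation (p : ℕ) .{{_ : NonZero p}} (1<p : 1 < p) {n : ℕ} (Φ : List (NClause p n)) (S : ℕ)
                          (lcomb-lines : ℕ) (simulate-lcomb : Simulation.LcombSimulation p 1<p Φ S lcomb-lines) where
  open Translation p {n}
  open Simulation p 1<p Φ S

  lines-per-step : ℕ
  lines-per-step = 1 + p * (2 * p) + lcomb-lines

  Simulated : List Clause → List (NClause p n) → Set
  Simulated π πᴺ = ∀ K → K ∈ πᴺ → Σ Clause λ Γ → Γ ∈ π × Γ ⊑ (_∈ ⟨ K ⟩)

  simulate-step : ∀ {prev K π} → NJustified p Φ prev K → Derivation π → Simulated π prev → length K ≤ S →
                  Simulates π K lines-per-step
  simulate-step (ax K∈Φ) d _ K≤S = relax (simulate-ax d K∈Φ K≤S) (s≤s z≤n) λ P → P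
  simulate-step (bool i k 2≤k K≈) d _ _ = relax (simulate-bool d i k 2≤k K≈) (s≤s z≤n) λ P → P
  simulate-step (res f Lᶠ Cᶠ L∈ L≈ K≈) d sim K≤S =
    relax (ResolutionRule.simulate K≤S f Lᶠ Cᶠ L≈ K≈ d λ j → sim (Lᶠ j) (L∈ j))
          (ℕP.≤-trans (ℕP.m≤n+m (p * (2 * p)) 1) (ℕP.m≤m+n (1 + p * (2 * p)) lcomb-lines)) λ P → P
  simulate-step (simp L C L∈ L≈ K≈) d sim _ with sim L L∈
  ... | Γ , Γ∈ , Γ⊑ = relax (simulate-simp d Γ Γ∈ Γ⊑ L≈ K≈) z≤n λ P → P
  simulate-step (lcomb L C f g a b L∈ L≈ K≈) d sim K≤S with sim L L∈
  ... | Γ , Γ∈ , Γ⊑ = relax (simulate-lcomb d K≤S f g a b Γ Γ∈ Γ⊑ L≈ K≈) (ℕP.m≤n+m lcomb-lines (1 + p * (2 * p))) λ P → P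

  simulate : ∀ {πᴺ} → NDerivation p Φ πᴺ → (∀ K → K ∈ πᴺ → length K ≤ S) →
             Σ (List Clause) λ π → Derivation π × Simulated π πᴺ × length π ≤ length πᴺ * lines-per-step × All Narrow π
  simulate [] _ = [] , [] , (λ _ ()) , z≤n , []
  simulate {K ∷ πᴺ} (j ∷ dᴺ) K≤S with simulate dᴺ (λ K′ K′∈ → K≤S K′ (there K′∈))
  ... | π , d , sim , len , nar with simulate-step j d sim (K≤S K (here refl))
  ...   | reach new d′ Γ Γ∈ Γ⊑ len′ nar′ = new ++ π , d′ , sim′ , len″ , AllP.++⁺ nar′ nar
    where
    sim′ : Simulated (new ++ π) (K ∷ πᴺ)
    sim′ _ (here refl) = Γ , Γ∈ , Γ⊑
    sim′ K′ (there K′∈) with sim K′ K′∈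
    ... | Γ′ , Γ′∈ , Γ′⊑ = Γ′ , ∈-++⁺ʳ new Γ′∈ , Γ′⊑
    len″ : length (new ++ π) ≤ suc (length πᴺ) * lines-per-step
    len″ = subst (_≤ suc (length πᴺ) * lines-per-step) (sym (LP.length-++ new)) (ℕP.+-mono-≤ len′ len)

lcomb-lines : ℕ → ℕ → ℕ
lcomb-lines p zero    = 0
lcomb-lines p (suc m) = image-lines + (image-lines + p * (1 + 2 * p))
  where image-lines = 3 + m * (1 + 2 * p)

simulate-lcomb : ∀ p .{{_ : NonZero p}} (1<p : 1 < p) n (Φ : List (NClause p n)) S →
                 Simulation.LcombSimulation p 1<p Φ S (lcomb-lines p n)
simulate-lcomb p 1<p zero    Φ S = simulate-lcomb-closed p 1<p Φ S
simulate-lcomb p 1<p (suc m) Φ S = LcombWithVariables.simulate-lcomb p 1<p Φ S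

nnz-≤-length : ∀ p .{{_ : NonZero p}} (as : List (F p)) → nnz p as ≤ length as
nnz-≤-length p [] = z≤n
nnz-≤-length p (a ∷ as) with ⌊ a FinP.≟ 0F p ⌋
... | true  = ℕP.≤-trans (nnz-≤-length p as) (ℕP.n≤1+n _)
... | false = s≤s (nnz-≤-length p as)

sizeLin-≤ : ∀ p .{{_ : NonZero p}} {n} (f : Lin p n) → sizeLin p f ≤ suc n
sizeLin-≤ p (lin cs k) = ℕP.≤-trans (nnz-≤-length p (k ∷ V.toList cs)) (s≤s (ℕP.≤-reflexive (VP.length-toList cs)))

sum-map-≤ : ∀ {A : Set} (g : A → ℕ) {B} → (∀ x → g x ≤ B) → ∀ xs → sum (L.map g xs) ≤ length xs * B
sum-map-≤ g g≤B []       = z≤n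
sum-map-≤ g g≤B (x ∷ xs) = ℕP.+-mono-≤ (g≤B x) (sum-map-≤ g g≤B xs)

length-≤-sum-map : ∀ {A : Set} (g : A → ℕ) → (∀ x → 1 ≤ g x) → ∀ xs → length xs ≤ sum (L.map g xs)
length-≤-sum-map g 1≤g []       = z≤n
length-≤-sum-map g 1≤g (x ∷ xs) = ℕP.+-mono-≤ (1≤g x) (length-≤-sum-map g 1≤g xs)

∈-≤-sum-map : ∀ {A : Set} (g : A → ℕ) {x} xs → x ∈ xs → g x ≤ sum (L.map g xs)
∈-≤-sum-map g (y ∷ xs) (here refl) = ℕP.m≤m+n (g y) _
∈-≤-sum-map g (y ∷ xs) (there x∈)  = ℕP.≤-trans (∈-≤-sum-map g xs x∈) (ℕP.m≤n+m _ (g y))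

sizeL-≤ : ∀ p .{{_ : NonZero p}} {n} W (π : List (LClause p n)) → All (λ K → length K ≤ W) π →
          sizeL p π ≤ length π * suc (W * (2 + n))
sizeL-≤ p W [] _ = z≤n
sizeL-≤ p {n} W (K ∷ π) (K≤W ∷ π≤W) = ℕP.+-mono-≤ (s≤s sum≤) (sizeL-≤ p W π π≤W)
  where
  sum≤ : sum (L.map (λ f → suc (sizeLin p f)) K) ≤ W * (2 + n)
  sum≤ = ℕP.≤-trans (sum-map-≤ (λ f → suc (sizeLin p f)) (λ f → s≤s (sizeLin-≤ p f)) K) (ℕP.*-monoˡ-≤ (2 + n) K≤W)

length-≤-sizeN : ∀ p .{{_ : NonZero p}} {n} (π : List (NClause p n)) → length π ≤ sizeN p π
length-≤-sizeN p = length-≤-sum-map (sizeNClause p) λ _ → s≤s z≤n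

clause-length-≤-sizeN : ∀ p .{{_ : NonZero p}} {n} {K} (π : List (NClause p n)) → K ∈ π → length K ≤ sizeN p π
clause-length-≤-sizeN p {K = K} π K∈ = ℕP.≤-trans
  (ℕP.≤-trans (length-≤-sum-map (λ l → suc (sizeLin p (proj₁ l)) + nnz p (proj₂ l ∷ [])) (λ _ → s≤s z≤n) K) (ℕP.n≤1+n _))
  (∈-≤-sum-map (sizeNClause p) π K∈)

module Arithmetic where
  open +-*-Solver

  ≤-by-slack : ∀ {a b} e → a + e ≡ b → a ≤ b
  ≤-by-slack {a} e eq = subst (a ≤_) eq (ℕP.m≤m+n a e)

  quartic : ℕ → Poly
  quartic C = C ∷ 4 * C ∷ 6 * C ∷ 4 * C ∷ C ∷ []

  evalPoly-quartic : ∀ C x → evalPoly (quartic C) x ≡ C * ((x + 1) * (x + 1) * (x + 1) * (x + 1))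
  evalPoly-quartic = solve 2 (λ C x → C :+ x :* (con 4 :* C :+ x :* (con 6 :* C :+ x :* (con 4 :* C :+ x :* (C :+ x :* con 0))))
                                  := C :* ((x :+ con 1) :* (x :+ con 1) :* (x :+ con 1) :* (x :+ con 1))) refl

  lines-per-step-constant : ℕ → ℕ
  lines-per-step-constant p = 4 * p * p + 5 * p + 9

  line-size-constant : ℕ → ℕ
  line-size-constant p = 10 * p + 5

  lcomb-lines≤ : ∀ p n → lcomb-lines p n ≤ 6 + 2 * n * (1 + 2 * p) + p * (1 + 2 * p)
  lcomb-lines≤ p zero    = z≤n
  lcomb-lines≤ p (suc m) = ≤-by-slack (2 * (1 + 2 * p)) (solve 2 (λ p m →
    (con 3 :+ m :* (con 1 :+ con 2 :* p)) :+ ((con 3 :+ m :* (con 1 :+ con 2 :* p)) :+ p :* (con 1 :+ con 2 :* p)) :+ con 2 :* (con 1 :+ con 2 :* p)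
      := con 6 :+ con 2 :* (con 1 :+ m) :* (con 1 :+ con 2 :* p) :+ p :* (con 1 :+ con 2 :* p)) refl p m)

  lines-per-step≤ : ∀ p n S → 1 + p * (2 * p) + lcomb-lines p n ≤ lines-per-step-constant p * (S + n + 1)
  lines-per-step≤ p n S = ℕP.≤-trans (ℕP.+-monoʳ-≤ (1 + p * (2 * p)) (lcomb-lines≤ p n))
    (≤-by-slack (4 * p * p * S + 5 * p * S + 9 * S + 4 * p * p * n + p * n + 7 * n + 4 * p + 2)
      (solve 3 (λ p n S → con 1 :+ p :* (con 2 :* p) :+ (con 6 :+ con 2 :* n :* (con 1 :+ con 2 :* p) :+ p :* (con 1 :+ con 2 :* p))
                           :+ (con 4 :* p :* p :* S :+ con 5 :* p :* S :+ con 9 :* S :+ con 4 :* p :* p :* n :+ p :* n :+ con 7 :* n :+ con 4 :* p :+ con 2)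
                         := (con 4 :* p :* p :+ con 5 :* p :+ con 9) :* (S :+ n :+ con 1)) refl p n S))

  line-size≤ : ∀ p n S → suc ((p * S + 4 * p + 2) * (2 + n)) ≤ line-size-constant p * ((S + n + 1) * (S + n + 1))
  line-size≤ p n S = ≤-by-slack (10 * p * S * S + 10 * p * n * n + 2 * p + 19 * p * S * n + 18 * p * S + 16 * p * n + 5 * S * S + 5 * n * n + 10 * S * n + 10 * S + 8 * n)
    (solve 3 (λ p n S → con 1 :+ (p :* S :+ con 4 :* p :+ con 2) :* (con 2 :+ n)
       :+ (con 10 :* p :* S :* S :+ con 10 :* p :* n :* n :+ con 2 :* p :+ con 19 :* p :* S :* n :+ con 18 :* p :* S :+ con 16 :* p :* n :+ con 5 :* S :* S :+ con 5 :* n :* n :+ con 10 :* S :* n :+ con 10 :* S :+ con 8 :* n)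
       := (con 10 :* p :+ con 5) :* ((S :+ n :+ con 1) :* (S :+ n :+ con 1))) refl p n S)

  simulation-size : ℕ → Poly
  simulation-size p = quartic (lines-per-step-constant p * line-size-constant p)

  product≤simulation-size : ∀ p n S {L M Z} → L ≤ S → M ≤ lines-per-step-constant p * (S + n + 1) →
                            Z ≤ line-size-constant p * ((S + n + 1) * (S + n + 1)) → L * M * Z ≤ evalPoly (simulation-size p) (S + n)
  product≤simulation-size p n S L≤ M≤ Z≤ = ℕP.≤-trans
    (ℕP.*-mono-≤ (ℕP.*-mono-≤ (ℕP.≤-trans L≤ (ℕP.≤-trans (ℕP.m≤m+n S n) (ℕP.m≤m+n (S + n) 1))) M≤) Z≤)
    (ℕP.≤-reflexive (trans (solve 3 (λ c d x → x :* (c :* x) :* (d :* (x :* x)) := c :* d :* (x :* x :* x :* x)) refl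
                                     (lines-per-step-constant p) (line-size-constant p) (S + n + 1))
                           (sym (evalPoly-quartic _ (S + n)))))

derivation-suffix : ∀ {p} .{{_ : NonZero p}} {n} {Φ : List (LClause p n)} ys {zs} →
                    LDerivation p Φ (ys ++ zs) → LDerivation p Φ zs
derivation-suffix []       d       = d
derivation-suffix (y ∷ ys) (_ ∷ d) = derivation-suffix ys d

module _ (p : ℕ) .{{_ : NonZero p}} (1<p : 1 < p) {n : ℕ} (Φ : List (NClause p n)) (rest : List (NClause p n)) where
  open Arithmetic
  open Simulation p 1<p Φ (sizeN p ([] ∷ rest)) using (W; Clause; _⊑_)
  open SimulateDerivation p 1<p Φ (sizeN p ([] ∷ rest)) (lcomb-lines p n) (simulate-lcomb p 1<p n Φ _)

  ⊑-empty : (Γ : Clause) → Γ ⊑ (_∈ transClause p []) → Γ ≡ []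
  ⊑-empty []      _  = refl
  ⊑-empty (x ∷ Γ) Γ⊑ with Γ⊑ x (here refl)
  ... | ()

  simulate-refutation : NDerivation p Φ ([] ∷ rest) →
    Σ (List (LClause p n)) λ π → LRefutation p (L.map (transClause p) Φ) π ×
                                 sizeL p π ≤ evalPoly (simulation-size p) (sizeN p ([] ∷ rest) + n)
  simulate-refutation dᴺ with simulate dᴺ (λ K K∈ → clause-length-≤-sizeN p ([] ∷ rest) K∈)
  ... | π , d , sim , len , narrow with sim [] (here refl)
  ... | Γ , Γ∈ , Γ⊑ with ⊑-empty Γ Γ⊑
  ... | refl with ∈-∃++ Γ∈
  ... | ys , zs , refl = [] ∷ zs , (derivation-suffix ys d , zs , refl) , size≤
    where
    S = sizeN p ([] ∷ rest)
    size≤ : sizeL p ([] ∷ zs) ≤ evalPoly (simulation-size p) (S + n)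
    size≤ = begin
      sizeL p ([] ∷ zs)                                     ≤⟨ sizeL-≤ p W ([] ∷ zs) (AllP.++⁻ʳ ys narrow) ⟩
      length ([] ∷ zs) * suc (W * (2 + n))
        ≤⟨ ℕP.*-monoˡ-≤ _ (ℕP.≤-trans (ℕP.m≤n+m _ (length ys)) (ℕP.≤-reflexive (sym (LP.length-++ ys)))) ⟩
      length (ys ++ [] ∷ zs) * suc (W * (2 + n))            ≤⟨ ℕP.*-monoˡ-≤ _ len ⟩
      length ([] ∷ rest) * lines-per-step * suc (W * (2 + n))
        ≤⟨ product≤simulation-size p n S (length-≤-sizeN p ([] ∷ rest)) (lines-per-step≤ p n S) (line-size≤ p n S) ⟩
      evalPoly (simulation-size p) (S + n)                  ∎
      where open ℕP.≤-Reasoning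

proposition3p1 : (p : ℕ) → .{{_ : NonZero p}} → Prime p → 5 ≤ p →
    Σ Poly λ q → (n : ℕ) (Φ : List (NClause p n)) (π : List (NClause p n)) →
      NRefutation p Φ π →
      Σ (List (LClause p n)) λ π′ →
        LRefutation p (L.map (transClause p) Φ) π′ × sizeL p π′ ≤ evalPoly q (sizeN p π + n)
proposition3p1 p _ 5≤p = simulation-size p , λ { n Φ .([] ∷ rest) (dᴺ , rest , refl) → simulate-refutation p 1<p Φ rest dᴺ }
  where
  open Arithmetic using (simulation-size)
  1<p : 1 < p
  1<p = ℕP.≤-trans (s≤s (s≤s z≤n)) 5≤p
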